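{- Let $g$ be a (real-valued) function of partitions and $\mu$ a given partition. Then for every nonnegative integer $n$, $$\sum_{|\lambda/\mu|=n}f_{\lambda/\mu}\,g(\lambda)=\sum_{k=0}^n\binom{n}{k}D^kg(\mu)$$ and $$D^ng(\mu)=\sum_{k=0}^n(-1)^{n+k}\binom{n}{k}\sum_{|\lambda/\mu|=k}f_{\lambda/\mu}\,g(\lambda).$$ In particular, if there exists a positive integer $r$ such that $D^rg(\lambda)=0$ for every partition $\lambda$, then $\sum_{|\lambda/\mu|=n}f_{\lambda/\mu}g(\lambda)$ is a polynomial in $n$.
   Context: Partitions are identified with Young diagrams. The sum over $|\lambda/\mu|=n$ ranges over partitions $\lambda\supseteq\mu$ with $|\lambda|-|\mu|=n$; $f_{\lambda/\mu}$ is the number of standard Young tableaux of skew shape $\lambda/\mu$ (fillings of the boxes of $\lambda/\mu$ by $1,\ldots,n$ increasing along rows and columns), with $f_{\mu/\mu}=1$. For a function $g$ on partitions, $Dg(\lambda)=\sum_{\lambda^+}g(\lambda^+)-g(\lambda)$, where $\lambda^+$ ranges over all partitions obtained from $\lambda$ by adding one box; $D^0g=g$, $D^kg=D(D^{k-1}g)$, and $D^kg(\mu)$ denotes $D^kg$ evaluated at $\mu$. -}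

module Defs where

open import Level using (Level)
open import Data.Bool using (Bool; true; false; T; _∧_; _∨_; not; if_then_else_; T?)
open import Data.Nat as ℕ using (ℕ; zero; suc; _≤_; _≡ᵇ_; _<ᵇ_; _≤ᵇ_)
open import Data.List using (List; []; _∷_; _++_; map; length; filter; concatMap; foldr; upTo; zip; lookup)
open import Data.Product using (Σ; _×_; _,_; proj₁; proj₂)
open import Relation.Nullary using (yes; no)
open import Relation.Binary.PropositionalEquality using (_≡_)
open import Function.Bundles using (_⇔_)
open import Data.List.Membership.Propositional using (_∈_)
open import Data.List.Relation.Unary.Unique.Propositional using (Unique)
open import Algebra.Bundles using (CommutativeRing)

-- Partitions: finite weakly decreasing lists of positive integers
-- (row lengths of the Young diagram, top row first).

isPart : List ℕ → Bool
isPart [] = true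
isPart (a ∷ []) = 1 ≤ᵇ a
isPart (a ∷ b ∷ l) = (b ≤ᵇ a) ∧ isPart (b ∷ l)

Partition : Set
Partition = Σ (List ℕ) (λ l → T (isPart l))

-- i-th row length (0-indexed), 0 beyond the last row
row : List ℕ → ℕ → ℕ
row [] i = 0
row (a ∷ l) zero = a
row (a ∷ l) (suc i) = row l i

size : Partition → ℕ
size (l , _) = foldr ℕ._+_ 0 l

_⊆ₚ_ : Partition → Partition → Set
(m , _) ⊆ₚ (l , _) = ∀ i → row m i ≤ row l i

-- Adding one box: λ⁺ ranges over all partitions obtained by adding one box
-- to λ, i.e. adding 1 to some row i (0 ≤ i ≤ number of rows), whenever the
-- result is again a partition.

incAt : ℕ → List ℕ → List ℕ
incAt zero [] = 1 ∷ []
incAt zero (a ∷ l) = suc a ∷ l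
incAt (suc i) [] = 0 ∷ incAt i []   -- never a partition for i ≥ 0 beyond length
incAt (suc i) (a ∷ l) = a ∷ incAt i l

asPartition : List ℕ → List Partition
asPartition l with T? (isPart l)
... | yes p = (l , p) ∷ []
... | no _ = []

plusBoxes : Partition → List Partition
plusBoxes (l , _) = concatMap (λ i → asPartition (incAt i l)) (upTo (suc (length l)))

-- the boxes (i , j) of λ/μ (0-indexed row i, column j), listed row by row
rowBoxes : ℕ → ℕ → ℕ → List (ℕ × ℕ)
rowBoxes i from zero = []
rowBoxes i from (suc k) = (i , from) ∷ rowBoxes i (suc from) k

skewBoxes : Partition → Partition → List (ℕ × ℕ)
skewBoxes (m , _) (l , _) =
  concatMap (λ i → rowBoxes i (row m i) (row l i ℕ.∸ row m i)) (upTo (length l))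

allLists : ℕ → List ℕ → List (List ℕ)
allLists zero xs = [] ∷ []
allLists (suc k) xs = concatMap (λ x → map (x ∷_) (allLists k xs)) xs

eqPair : ℕ × ℕ → ℕ × ℕ → Bool
eqPair (a , b) (c , d) = (a ≡ᵇ c) ∧ (b ≡ᵇ d)

allB : {A : Set} → (A → Bool) → List A → Bool
allB p [] = true
allB p (x ∷ xs) = p x ∧ allB p xs

distinct : List ℕ → Bool
distinct [] = true
distinct (x ∷ xs) = allB (λ y → not (x ≡ᵇ y)) xs ∧ distinct xs

increasing : List ((ℕ × ℕ) × ℕ) → Bool
increasing bt =
  allB (λ { ((i , j) , t) → allB (λ { (b' , t') →
      if eqPair b' (i , suc j) ∨ eqPair b' (suc i , j) then t <ᵇ t' else true }) bt }) bt

isSYT : List (ℕ × ℕ) → List ℕ → Bool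
isSYT bs ts = distinct ts ∧ increasing (zip bs ts)

-- f_{λ/μ}: number of fillings of the boxes of λ/μ by 1,…,n (n = |λ/μ|),
-- bijective, increasing along rows and columns.  (f_{μ/μ} = 1.)
fSkew : Partition → Partition → ℕ
fSkew μ la = length (filter (λ ts → T? (isSYT (skewBoxes μ la) ts))
  (allLists (length (skewBoxes μ la)) (map suc (upTo (length (skewBoxes μ la))))))

-- L lists (without repetition) exactly the partitions λ ⊇ μ with |λ| - |μ| = n
SkewListing : Partition → ℕ → List Partition → Set
SkewListing μ n L = Unique L × (∀ la → (la ∈ L) ⇔ ((μ ⊆ₚ la) × (size la ≡ size μ ℕ.+ n)))

module WithRing {c ℓ : Level} (R : CommutativeRing c ℓ) where
  open CommutativeRing R

  sumR : List Carrier → Carrier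
  sumR = foldr _+_ 0#

  natCast : ℕ → Carrier
  natCast zero = 0#
  natCast (suc n) = 1# + natCast n

  negOnePow : ℕ → Carrier
  negOnePow zero = 1#
  negOnePow (suc m) = - negOnePow m

  sumUpTo : ℕ → (ℕ → Carrier) → Carrier
  sumUpTo n h = sumR (map h (upTo (suc n)))

  D : (Partition → Carrier) → Partition → Carrier
  D g la = sumR (map g (plusBoxes la)) - g la

  Dpow : ℕ → (Partition → Carrier) → Partition → Carrier
  Dpow zero g = g
  Dpow (suc k) g = D (Dpow k g)

  skewSum : (Partition → Carrier) → Partition → List Partition → Carrier
  skewSum g μ L = sumR (map (λ λ' → natCast (fSkew μ λ') * g λ') L)

  -- evaluation of the polynomial with coefficient list cs (constant term first)
  evalPoly : List Carrier → Carrier → Carrier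
  evalPoly [] x = 0#
  evalPoly (a ∷ cs) x = a + x * evalPoly cs x

module Submission where

-- Write E h(ν) = Σ_{ν⁺} h(ν⁺) for the operator "add one box", so D = E - 1.
-- The combinatorial heart is the first-label recursion
--   f_{λ/μ} = Σ_{μ⁺ ⊆ λ} f_{λ/μ⁺}      (μ ⊊ λ),      f_{μ/μ} = 1,
-- (in a standard filling the box labelled 1 is an addable corner of μ), which
-- by induction on n identifies the level-n sum with Eⁿg(μ).  The rest is
-- algebra: E and D commute, so Eⁿ = (D + 1)ⁿ and Dⁿ = (E - 1)ⁿ expand by Pascal's
-- rule; if Dʳg ≡ 0 the first expansion stops at k < r, and each C(n,k) is a
-- polynomial in n once the positive integers are invertible.

open import Defs
open import Level using (Level)
open import Data.Nat using (ℕ; suc; _≤_) renaming (_+_ to _+ℕ_)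
open import Data.Nat.Combinatorics using (_C_)
open import Data.List using (List)
open import Data.Product using (_×_; ∃; _,_)
open import Algebra.Bundles using (CommutativeRing)
import Relation.Binary.PropositionalEquality as P

module Booleans where

  open import Data.Bool using (Bool; true; false; T; _∧_; _∨_; not; if_then_else_)
  open import Data.Bool.Properties using (∧-commutativeMonoid)
  open import Data.Unit using (tt)
  open import Data.Nat using (zero; _<_; _≡ᵇ_; _<ᵇ_; _≤ᵇ_)
  open import Data.Nat.Properties using (≡ᵇ⇒≡; ≤ᵇ⇒≤; ≤⇒≤ᵇ; <ᵇ⇒<; <⇒<ᵇ; <⇒≱)
  open import Data.List using ([]; _∷_; map)
  open import Data.List.Membership.Propositional using (_∈_)
  open import Data.List.Relation.Unary.Any using (here; there)
  open import Data.Product using (_,_; proj₁; proj₂)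
  open import Data.Sum using (_⊎_; inj₁; inj₂)
  open import Data.Empty using (⊥; ⊥-elim)
  open import Relation.Binary.PropositionalEquality
  open import Function using (_∘_)
  open import Algebra.Bundles using (CommutativeMonoid)
  open import Algebra.Properties.CommutativeSemigroup
    (CommutativeMonoid.commutativeSemigroup ∧-commutativeMonoid) public
    using () renaming (interchange to ∧-interchange; x∙yz≈y∙xz to ∧-leftComm)

  toT : ∀ {b} → b ≡ true → T b
  toT refl = tt

  fromT : ∀ {b} → T b → b ≡ true
  fromT {true} _ = refl

  false≢true : false ≡ true → ⊥
  false≢true ()

  bool-ext : ∀ {a b : Bool} → (a ≡ true → b ≡ true) → (b ≡ true → a ≡ true) → a ≡ b
  bool-ext {true} {true} f g = refl
  bool-ext {true} {false} f g = sym (f refl)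
  bool-ext {false} {true} f g = g refl
  bool-ext {false} {false} f g = refl

  not-true : ∀ {b : Bool} → (b ≡ true → ⊥) → b ≡ false
  not-true {true} h = ⊥-elim (h refl)
  not-true {false} h = refl

  ∧-split : ∀ x y → x ∧ y ≡ true → x ≡ true × y ≡ true
  ∧-split true true e = refl , refl

  ∨-split : ∀ x y → x ∨ y ≡ true → x ≡ true ⊎ y ≡ true
  ∨-split true y e = inj₁ refl
  ∨-split false y e = inj₂ e

  ∨-true : ∀ x → x ∨ true ≡ true
  ∨-true true = refl
  ∨-true false = refl

  if-same : ∀ (c : Bool) → (if c then true else true) ≡ true
  if-same true = refl
  if-same false = refl

  if-not : ∀ (c : Bool) → (if c then false else true) ≡ not c
  if-not true = refl
  if-not false = refl

  ≡ᵇ-refl : ∀ n → (n ≡ᵇ n) ≡ true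
  ≡ᵇ-refl zero = refl
  ≡ᵇ-refl (suc n) = ≡ᵇ-refl n

  ≡ᵇ-sym : ∀ m n → (m ≡ᵇ n) ≡ (n ≡ᵇ m)
  ≡ᵇ-sym zero zero = refl
  ≡ᵇ-sym zero (suc n) = refl
  ≡ᵇ-sym (suc m) zero = refl
  ≡ᵇ-sym (suc m) (suc n) = ≡ᵇ-sym m n

  ≡ᵇ-suc : ∀ n → (n ≡ᵇ suc n) ≡ false
  ≡ᵇ-suc zero = refl
  ≡ᵇ-suc (suc n) = ≡ᵇ-suc n

  ≡ᵇ-true : ∀ m n → (m ≡ᵇ n) ≡ true → m ≡ n
  ≡ᵇ-true m n e = ≡ᵇ⇒≡ m n (toT e)

  ≡ᵇ-false : ∀ m n → m ≢ n → (m ≡ᵇ n) ≡ false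
  ≡ᵇ-false m n ne = not-true (λ e → ne (≡ᵇ-true m n e))

  ≤ᵇ-true : ∀ m n → (m ≤ᵇ n) ≡ true → m ≤ n
  ≤ᵇ-true m n e = ≤ᵇ⇒≤ m n (toT e)

  ≤-≤ᵇ : ∀ {m n} → m ≤ n → (m ≤ᵇ n) ≡ true
  ≤-≤ᵇ le = fromT (≤⇒≤ᵇ le)

  <ᵇ-true : ∀ m n → (m <ᵇ n) ≡ true → m < n
  <ᵇ-true m n e = <ᵇ⇒< m n (toT e)

  <-<ᵇ : ∀ {m n} → m < n → (m <ᵇ n) ≡ true
  <-<ᵇ lt = fromT (<⇒<ᵇ lt)

  <ᵇ-false : ∀ m n → n ≤ m → (m <ᵇ n) ≡ false
  <ᵇ-false m n le = not-true (λ e → <⇒≱ (<ᵇ-true m n e) le)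

  allB-map : ∀ {A B : Set} (q : B → Bool) (f : A → B) xs → allB q (map f xs) ≡ allB (q ∘ f) xs
  allB-map q f [] = refl
  allB-map q f (x ∷ xs) = cong (q (f x) ∧_) (allB-map q f xs)

  allB-cong : ∀ {A : Set} {p q : A → Bool} → (∀ x → p x ≡ q x) → ∀ xs → allB p xs ≡ allB q xs
  allB-cong e [] = refl
  allB-cong e (x ∷ xs) = cong₂ _∧_ (e x) (allB-cong e xs)

  allB-∧ : ∀ {A : Set} (p q : A → Bool) xs → allB (λ x → p x ∧ q x) xs ≡ allB p xs ∧ allB q xs
  allB-∧ p q [] = refl
  allB-∧ p q (x ∷ xs) = trans (cong ((p x ∧ q x) ∧_) (allB-∧ p q xs)) (∧-interchange (p x) (q x) (allB p xs) (allB q xs))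

  allB-head : ∀ {A : Set} (p : A → Bool) x xs → allB p (x ∷ xs) ≡ true → p x ≡ true
  allB-head p x xs e = proj₁ (∧-split (p x) (allB p xs) e)

  allB-tail : ∀ {A : Set} (p : A → Bool) x xs → allB p (x ∷ xs) ≡ true → allB p xs ≡ true
  allB-tail p x xs e = proj₂ (∧-split (p x) (allB p xs) e)

  allB-impl : ∀ {A : Set} (p q : A → Bool) → (∀ x → p x ≡ true → q x ≡ true) → ∀ xs → allB p xs ≡ true → allB q xs ≡ true
  allB-impl p q h [] e = refl
  allB-impl p q h (x ∷ xs) e rewrite h x (allB-head p x xs e) = allB-impl p q h xs (allB-tail p x xs e)

  allB-true : ∀ {A : Set} (p : A → Bool) → (∀ x → p x ≡ true) → ∀ xs → allB p xs ≡ true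
  allB-true p h [] = refl
  allB-true p h (x ∷ xs) rewrite h x = allB-true p h xs

  allB-∈ : ∀ {A : Set} (q : A → Bool) xs → allB q xs ≡ true → ∀ {x} → x ∈ xs → q x ≡ true
  allB-∈ q (y ∷ xs) h (here refl) = allB-head q y xs h
  allB-∈ q (y ∷ xs) h (there m) = allB-∈ q xs (allB-tail q y xs h) m

  allB-∈⁺ : ∀ {A : Set} (q : A → Bool) xs → (∀ x → x ∈ xs → q x ≡ true) → allB q xs ≡ true
  allB-∈⁺ q [] h = refl
  allB-∈⁺ q (x ∷ xs) h rewrite h x (here refl) = allB-∈⁺ q xs (λ y m → h y (there m))

  allB-∈⁻ : ∀ {A : Set} (q : A → Bool) xs {x} → x ∈ xs → q x ≡ false → allB q xs ≡ false
  allB-∈⁻ q xs m e = not-true (λ h → false≢true (trans (sym e) (allB-∈ q xs h m)))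

module NatSums where

  open import Data.Bool using (Bool; true; false; _∧_; T?)
  open import Data.Nat using (zero; _+_; _*_; _<_; z≤n; s≤s)
  open import Data.Nat.Properties
    using (+-identityʳ; +-assoc; +-comm; +-suc; *-zeroʳ; *-distribˡ-+; m≤m+n; +-commutativeSemigroup)
  open import Algebra.Properties.CommutativeSemigroup +-commutativeSemigroup
    using () renaming (interchange to +-interchange)
  open import Data.List using ([]; _∷_; _++_; map; length; filter; concatMap; upTo; applyUpTo)
  open import Relation.Binary.PropositionalEquality
  open import Function using (_∘_)
  open Booleans using (allB-head; allB-tail)

  χ : Bool → ℕ
  χ true = 1
  χ false = 0

  χ-∧ : ∀ x y → χ (x ∧ y) ≡ χ x * χ y
  χ-∧ true y = sym (+-identityʳ (χ y))
  χ-∧ false y = refl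

  Σℕ : {A : Set} → (A → ℕ) → List A → ℕ
  Σℕ f [] = 0
  Σℕ f (x ∷ xs) = f x + Σℕ f xs

  Σr : ℕ → (ℕ → ℕ) → ℕ
  Σr zero f = 0
  Σr (suc n) f = f 0 + Σr n (λ i → f (suc i))

  Σℕ-++ : ∀ {A : Set} (f : A → ℕ) xs ys → Σℕ f (xs ++ ys) ≡ Σℕ f xs + Σℕ f ys
  Σℕ-++ f [] ys = refl
  Σℕ-++ f (x ∷ xs) ys = trans (cong (f x +_) (Σℕ-++ f xs ys)) (sym (+-assoc (f x) _ _))

  Σℕ-map : ∀ {A B : Set} (f : B → ℕ) (g : A → B) xs → Σℕ f (map g xs) ≡ Σℕ (f ∘ g) xs
  Σℕ-map f g [] = refl
  Σℕ-map f g (x ∷ xs) = cong (f (g x) +_) (Σℕ-map f g xs)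

  Σℕ-concatMap : ∀ {A B : Set} (f : B → ℕ) (g : A → List B) xs → Σℕ f (concatMap g xs) ≡ Σℕ (λ x → Σℕ f (g x)) xs
  Σℕ-concatMap f g [] = refl
  Σℕ-concatMap f g (x ∷ xs) = trans (Σℕ-++ f (g x) (concatMap g xs)) (cong (Σℕ f (g x) +_) (Σℕ-concatMap f g xs))

  Σℕ-cong : ∀ {A : Set} {f g : A → ℕ} → (∀ x → f x ≡ g x) → ∀ xs → Σℕ f xs ≡ Σℕ g xs
  Σℕ-cong e [] = refl
  Σℕ-cong e (x ∷ xs) = cong₂ _+_ (e x) (Σℕ-cong e xs)

  Σℕ-congB : ∀ {A : Set} (P : A → Bool) {f g : A → ℕ} → (∀ x → P x ≡ true → f x ≡ g x) →
             ∀ xs → allB P xs ≡ true → Σℕ f xs ≡ Σℕ g xs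
  Σℕ-congB P e [] h = refl
  Σℕ-congB P e (x ∷ xs) h = cong₂ _+_ (e x (allB-head P x xs h)) (Σℕ-congB P e xs (allB-tail P x xs h))

  Σℕ-+ : ∀ {A : Set} (f g : A → ℕ) xs → Σℕ (λ x → f x + g x) xs ≡ Σℕ f xs + Σℕ g xs
  Σℕ-+ f g [] = refl
  Σℕ-+ f g (x ∷ xs) = trans (cong (f x + g x +_) (Σℕ-+ f g xs)) (+-interchange (f x) (g x) (Σℕ f xs) (Σℕ g xs))

  Σℕ-* : ∀ {A : Set} (c : ℕ) (f : A → ℕ) xs → Σℕ (λ x → c * f x) xs ≡ c * Σℕ f xs
  Σℕ-* c f [] = sym (*-zeroʳ c)
  Σℕ-* c f (x ∷ xs) = trans (cong (c * f x +_) (Σℕ-* c f xs)) (sym (*-distribˡ-+ c (f x) (Σℕ f xs)))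

  Σℕ-zero : ∀ {A : Set} (f : A → ℕ) → (∀ x → f x ≡ 0) → ∀ xs → Σℕ f xs ≡ 0
  Σℕ-zero f e [] = refl
  Σℕ-zero f e (x ∷ xs) = cong₂ _+_ (e x) (Σℕ-zero f e xs)

  Σr-cong : ∀ n {f g : ℕ → ℕ} → (∀ i → i < n → f i ≡ g i) → Σr n f ≡ Σr n g
  Σr-cong zero e = refl
  Σr-cong (suc n) e = cong₂ _+_ (e 0 (s≤s z≤n)) (Σr-cong n (λ i i<n → e (suc i) (s≤s i<n)))

  Σr-zero : ∀ n (f : ℕ → ℕ) → (∀ i → i < n → f i ≡ 0) → Σr n f ≡ 0
  Σr-zero zero f e = refl
  Σr-zero (suc n) f e = cong₂ _+_ (e 0 (s≤s z≤n)) (Σr-zero n (f ∘ suc) (λ i i<n → e (suc i) (s≤s i<n)))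

  Σr-Σℕ : ∀ {A : Set} n (F : ℕ → A → ℕ) xs → Σr n (λ p → Σℕ (F p) xs) ≡ Σℕ (λ x → Σr n (λ p → F p x)) xs
  Σr-Σℕ zero F xs = sym (Σℕ-zero _ (λ _ → refl) xs)
  Σr-Σℕ (suc n) F xs = trans (cong (Σℕ (F 0) xs +_) (Σr-Σℕ n (λ p → F (suc p)) xs)) (sym (Σℕ-+ (F 0) _ xs))

  Σℕ-applyUpTo : ∀ (f : ℕ → ℕ) (g : ℕ → ℕ) n → Σℕ f (applyUpTo g n) ≡ Σr n (f ∘ g)
  Σℕ-applyUpTo f g zero = refl
  Σℕ-applyUpTo f g (suc n) = cong (f (g 0) +_) (Σℕ-applyUpTo f (g ∘ suc) n)

  Σℕ-upTo : ∀ (f : ℕ → ℕ) n → Σℕ f (upTo n) ≡ Σr n f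
  Σℕ-upTo f n = Σℕ-applyUpTo f (λ i → i) n

  Σr-last : ∀ n (f : ℕ → ℕ) → Σr (suc n) f ≡ Σr n f + f n
  Σr-last zero f = +-comm (f 0) 0
  Σr-last (suc n) f = trans (cong (f 0 +_) (Σr-last n (λ i → f (suc i)))) (sym (+-assoc (f 0) _ _))

  Σr-extend : ∀ n d (f : ℕ → ℕ) → (∀ i → n ≤ i → f i ≡ 0) → Σr (n + d) f ≡ Σr n f
  Σr-extend n zero f e = cong (λ m → Σr m f) (+-identityʳ n)
  Σr-extend n (suc d) f e = begin
      Σr (n + suc d) f ≡⟨ cong (λ m → Σr m f) (+-suc n d) ⟩
      Σr (suc (n + d)) f ≡⟨ Σr-last (n + d) f ⟩
      Σr (n + d) f + f (n + d) ≡⟨ cong₂ _+_ (Σr-extend n d f e) (e (n + d) (m≤m+n n d)) ⟩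
      Σr n f + 0 ≡⟨ +-identityʳ _ ⟩
      Σr n f ∎
    where open ≡-Reasoning

  lenFilter : ∀ {A : Set} (p : A → Bool) xs → length (filter (λ x → T? (p x)) xs) ≡ Σℕ (λ x → χ (p x)) xs
  lenFilter p [] = refl
  lenFilter p (x ∷ xs) with p x
  ... | true = cong suc (lenFilter p xs)
  ... | false = lenFilter p xs

-- Splitting off the
-- position of a distinguished label a gives the recursion behind the
-- first-label decomposition of standard fillings.
module LabelLists where

  open import Data.Bool using (Bool; false; _∧_; not)
  open import Data.Nat using (zero; _+_; _<_; s≤s; _≡ᵇ_)
  open import Data.Nat.Properties using (+-identityʳ; +-comm; +-assoc; m≤n⇒m≤1+n)
  open import Data.Bool.Properties using (∧-zeroʳ)
  open import Data.List using ([]; _∷_; map; length)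
  open import Relation.Binary.PropositionalEquality
  open Booleans using (≡ᵇ-refl; ≡ᵇ-sym; ∧-interchange; ∧-leftComm)
  open NatSums

  ins : {A : Set} → ℕ → A → List A → List A
  ins zero a xs = a ∷ xs
  ins (suc p) a [] = a ∷ []
  ins (suc p) a (x ∷ xs) = x ∷ ins p a xs

  allLists-suc : ∀ (H : List ℕ → ℕ) k X →
    Σℕ H (allLists (suc k) X) ≡ Σℕ (λ x → Σℕ (λ ts → H (x ∷ ts)) (allLists k X)) X
  allLists-suc H k X = trans (Σℕ-concatMap H (λ x → map (x ∷_) (allLists k X)) X)
                             (Σℕ-cong (λ x → Σℕ-map H (x ∷_) (allLists k X)) X)

  allB-ins : ∀ {A : Set} (q : A → Bool) p a us → allB q (ins p a us) ≡ q a ∧ allB q us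
  allB-ins q zero a us = refl
  allB-ins q (suc p) a [] = refl
  allB-ins q (suc p) a (u ∷ us) = trans (cong (q u ∧_) (allB-ins q p a us)) (∧-leftComm (q u) (q a) _)

  distinct-ins : ∀ p a us → distinct (ins p a us) ≡ allB (λ y → not (a ≡ᵇ y)) us ∧ distinct us
  distinct-ins zero a us = refl
  distinct-ins (suc p) a [] = refl
  distinct-ins (suc p) a (u ∷ us) = begin
      allB (λ y → not (u ≡ᵇ y)) (ins p a us) ∧ distinct (ins p a us)
        ≡⟨ cong₂ _∧_ (allB-ins (λ y → not (u ≡ᵇ y)) p a us) (distinct-ins p a us) ⟩
      (not (u ≡ᵇ a) ∧ allB (λ y → not (u ≡ᵇ y)) us) ∧ (allB (λ y → not (a ≡ᵇ y)) us ∧ distinct us)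
        ≡⟨ cong (λ b → (not b ∧ allB (λ y → not (u ≡ᵇ y)) us) ∧ (allB (λ y → not (a ≡ᵇ y)) us ∧ distinct us)) (≡ᵇ-sym u a) ⟩
      (not (a ≡ᵇ u) ∧ allB (λ y → not (u ≡ᵇ y)) us) ∧ (allB (λ y → not (a ≡ᵇ y)) us ∧ distinct us)
        ≡⟨ ∧-interchange (not (a ≡ᵇ u)) _ _ _ ⟩
      (not (a ≡ᵇ u) ∧ allB (λ y → not (a ≡ᵇ y)) us) ∧ (allB (λ y → not (u ≡ᵇ y)) us ∧ distinct us) ∎
    where open ≡-Reasoning

  Σ-allLists-avoid : ∀ a Y k (H : List ℕ → ℕ) → (∀ ts → allB (λ y → not (a ≡ᵇ y)) ts ≡ false → H ts ≡ 0) →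
                     Σℕ H (allLists k (a ∷ Y)) ≡ Σℕ H (allLists k Y)
  Σ-allLists-avoid a Y zero H h = refl
  Σ-allLists-avoid a Y (suc k) H h = begin
      Σℕ H (allLists (suc k) (a ∷ Y))
        ≡⟨ allLists-suc H k (a ∷ Y) ⟩
      Σℕ (λ ts → H (a ∷ ts)) (allLists k (a ∷ Y)) + Σℕ (λ y → Σℕ (λ ts → H (y ∷ ts)) (allLists k (a ∷ Y))) Y
        ≡⟨ cong₂ _+_ (Σℕ-zero _ (λ ts → h (a ∷ ts) (cong (λ b → not b ∧ allB (λ y → not (a ≡ᵇ y)) ts) (≡ᵇ-refl a))) (allLists k (a ∷ Y)))
                     (Σℕ-cong (λ y → Σ-allLists-avoid a Y k (λ ts → H (y ∷ ts))
                                        (λ ts e → h (y ∷ ts) (trans (cong (not (a ≡ᵇ y) ∧_) e) (∧-zeroʳ _)))) Y) ⟩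
      0 + Σℕ (λ y → Σℕ (λ ts → H (y ∷ ts)) (allLists k Y)) Y
        ≡⟨ sym (allLists-suc H k Y) ⟩
      Σℕ H (allLists (suc k) Y) ∎
    where open ≡-Reasoning

  -- for H vanishing on lists with repeats, lists over a ∷ Y either avoid a or
  -- contain it exactly once, at one of the k+1 positions p
  Σ-allLists-insert : ∀ a Y (H : List ℕ → ℕ) → (∀ ts → distinct ts ≡ false → H ts ≡ 0) → ∀ k →
    Σℕ H (allLists (suc k) (a ∷ Y)) ≡ Σℕ H (allLists (suc k) Y) + Σr (suc k) (λ p → Σℕ (λ us → H (ins p a us)) (allLists k Y))
  Σ-allLists-insert a Y H h zero = begin
      Σℕ H (allLists 1 (a ∷ Y))
        ≡⟨ allLists-suc H 0 (a ∷ Y) ⟩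
      (H (a ∷ []) + 0) + Σℕ (λ y → H (y ∷ []) + 0) Y
        ≡⟨ +-comm (H (a ∷ []) + 0) _ ⟩
      Σℕ (λ y → H (y ∷ []) + 0) Y + (H (a ∷ []) + 0)
        ≡⟨ cong₂ _+_ (sym (allLists-suc H 0 Y)) (sym (+-identityʳ _)) ⟩
      Σℕ H (allLists 1 Y) + ((H (a ∷ []) + 0) + 0) ∎
    where open ≡-Reasoning
  Σ-allLists-insert a Y H h (suc k) = begin
      Σℕ H (allLists (suc (suc k)) (a ∷ Y))
        ≡⟨ allLists-suc H (suc k) (a ∷ Y) ⟩
      Σℕ (λ ts → H (a ∷ ts)) (allLists (suc k) (a ∷ Y)) + Σℕ (λ y → Σℕ (λ ts → H (y ∷ ts)) (allLists (suc k) (a ∷ Y))) Y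
        ≡⟨ cong₂ _+_ (Σ-allLists-avoid a Y (suc k) (λ ts → H (a ∷ ts)) (λ ts e → h (a ∷ ts) (cong (_∧ distinct ts) e)))
                     (Σℕ-cong (λ y → Σ-allLists-insert a Y (λ ts → H (y ∷ ts))
                                        (λ ts e → h (y ∷ ts) (trans (cong (allB (λ z → not (y ≡ᵇ z)) ts ∧_) e) (∧-zeroʳ _))) k) Y) ⟩
      A0 + Σℕ (λ y → Σℕ (λ ts → H (y ∷ ts)) (allLists (suc k) Y) + Σr (suc k) (λ p → F p y)) Y
        ≡⟨ cong (A0 +_) (Σℕ-+ _ _ Y) ⟩
      A0 + (Σℕ (λ y → Σℕ (λ ts → H (y ∷ ts)) (allLists (suc k) Y)) Y + B)
        ≡⟨ cong (λ z → A0 + (z + B)) (sym (allLists-suc H (suc k) Y)) ⟩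
      A0 + (S + B)
        ≡⟨ trans (sym (+-assoc A0 S B)) (trans (cong (_+ B) (+-comm A0 S)) (+-assoc S A0 B)) ⟩
      S + (A0 + B)
        ≡⟨ cong (λ z → S + (A0 + z)) (sym (Σr-Σℕ (suc k) F Y)) ⟩
      S + (A0 + Σr (suc k) (λ p → Σℕ (F p) Y))
        ≡⟨ cong (λ z → S + (A0 + z)) (Σr-cong (suc k) (λ p _ → sym (allLists-suc (λ us → H (ins (suc p) a us)) k Y))) ⟩
      S + Σr (suc (suc k)) (λ p → Σℕ (λ us → H (ins p a us)) (allLists (suc k) Y)) ∎
    where
    open ≡-Reasoning
    F : ℕ → ℕ → ℕ
    F p y = Σℕ (λ us → H (y ∷ ins p a us)) (allLists k Y)
    A0 S B : ℕ
    A0 = Σℕ (λ ts → H (a ∷ ts)) (allLists (suc k) Y)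
    S = Σℕ H (allLists (suc (suc k)) Y)
    B = Σℕ (λ y → Σr (suc k) (λ p → F p y)) Y

  -- pigeonhole: a list longer than the alphabet has a repeated entry
  Σ-allLists-pigeonhole : ∀ Y k (H : List ℕ → ℕ) → (∀ ts → distinct ts ≡ false → H ts ≡ 0) →
                          length Y < k → Σℕ H (allLists k Y) ≡ 0
  Σ-allLists-pigeonhole [] (suc k) H h lt = refl
  Σ-allLists-pigeonhole (y ∷ Y) (suc k) H h (s≤s lt) = begin
      Σℕ H (allLists (suc k) (y ∷ Y))
        ≡⟨ Σ-allLists-insert y Y H h k ⟩
      Σℕ H (allLists (suc k) Y) + Σr (suc k) (λ p → Σℕ (λ us → H (ins p y us)) (allLists k Y))
        ≡⟨ cong₂ _+_ (Σ-allLists-pigeonhole Y (suc k) H h (m≤n⇒m≤1+n lt))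
                     (Σr-zero (suc k) _ (λ p _ → Σ-allLists-pigeonhole Y k (λ us → H (ins p y us)) (hIns p) lt)) ⟩
      0 ∎
    where
    open ≡-Reasoning
    hIns : ∀ p us → distinct us ≡ false → H (ins p y us) ≡ 0
    hIns p us e = h (ins p y us) (trans (distinct-ins p y us) (trans (cong (allB (λ z → not (y ≡ᵇ z)) us ∧_) e) (∧-zeroʳ _)))

-- A box b is minimal in a list R if no box of R
-- has b as a successor: exactly the boxes that can carry the label 1.
module Fillings where

  open import Data.Bool using (Bool; true; false; _∧_; _∨_; not; if_then_else_)
  open import Data.Nat using (zero; _<_; s≤s; _≡ᵇ_; _<ᵇ_)
  open import Data.Nat.Properties using (suc-injective)
  open import Data.Bool.Properties using (∧-zeroʳ)
  open import Data.List using ([]; _∷_; map; length; zip)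
  open import Data.Product using (_,_; proj₁; proj₂)
  open import Relation.Binary.PropositionalEquality
  open import Function using (_∘_)
  open Booleans
  open LabelLists using (ins; allB-ins; distinct-ins)

  Box : Set
  Box = ℕ × ℕ

  successor : Box → Box → Bool
  successor (i , j) b' = eqPair b' (i , suc j) ∨ eqPair b' (suc i , j)

  ordered : Box × ℕ → Box × ℕ → Bool
  ordered (b , t) (b' , t') = if successor b b' then t <ᵇ t' else true

  minimal : Box → List Box → Bool
  minimal b R = allB (λ b' → not (successor b' b)) R

  successor-irrefl : ∀ b → successor b b ≡ false
  successor-irrefl (i , j) rewrite ≡ᵇ-suc j | ≡ᵇ-suc i | ∧-zeroʳ (i ≡ᵇ i) = refl

  nth : ℕ → List Box → Box
  nth p [] = (0 , 0)
  nth zero (x ∷ xs) = x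
  nth (suc p) (x ∷ xs) = nth p xs

  del : {A : Set} → ℕ → List A → List A
  del p [] = []
  del zero (x ∷ xs) = xs
  del (suc p) (x ∷ xs) = x ∷ del p xs

  length-del : ∀ p (bs : List Box) → p < length bs → suc (length (del p bs)) ≡ length bs
  length-del zero (b ∷ bs) lt = refl
  length-del (suc p) (b ∷ bs) (s≤s lt) = cong suc (length-del p bs lt)

  zip-ins : ∀ p (bs : List Box) (us : List ℕ) t → p < length bs → suc (length us) ≡ length bs →
            zip bs (ins p t us) ≡ ins p (nth p bs , t) (zip (del p bs) us)
  zip-ins zero (b ∷ bs) us t lt e = refl
  zip-ins (suc p) (b ∷ bs) (u ∷ us) t (s≤s lt) e = cong ((b , u) ∷_) (zip-ins p bs us t lt (suc-injective e))
  zip-ins (suc p) (b ∷ []) [] t (s≤s ()) e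
  zip-ins (suc p) (b ∷ b' ∷ bs) [] t lt ()

  allB-zip₂ : ∀ {A B : Set} (q : B → Bool) (xs : List A) ys → allB q ys ≡ true → allB (q ∘ proj₂) (zip xs ys) ≡ true
  allB-zip₂ q [] ys h = refl
  allB-zip₂ q (x ∷ xs) [] h = refl
  allB-zip₂ q (x ∷ xs) (y ∷ ys) h rewrite allB-head q y ys h = allB-zip₂ q xs ys (allB-tail q y ys h)

  allB-zip₁ : ∀ {A B : Set} (q : A → Bool) (xs : List A) (ys : List B) → length xs ≡ length ys →
              allB (q ∘ proj₁) (zip xs ys) ≡ allB q xs
  allB-zip₁ q [] [] e = refl
  allB-zip₁ q (x ∷ xs) (y ∷ ys) e = cong (q x ∧_) (allB-zip₁ q xs ys (suc-injective e))

  increasing-ins : ∀ p e bt → increasing (ins p e bt) ≡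
                   (ordered e e ∧ allB (ordered e) bt) ∧ (allB (λ x → ordered x e) bt ∧ increasing bt)
  increasing-ins p e bt = begin
      allB (λ x → allB (ordered x) (ins p e bt)) (ins p e bt)
        ≡⟨ allB-cong (λ x → allB-ins (ordered x) p e bt) (ins p e bt) ⟩
      allB (λ x → ordered x e ∧ allB (ordered x) bt) (ins p e bt)
        ≡⟨ allB-ins (λ x → ordered x e ∧ allB (ordered x) bt) p e bt ⟩
      (ordered e e ∧ allB (ordered e) bt) ∧ allB (λ x → ordered x e ∧ allB (ordered x) bt) bt
        ≡⟨ cong ((ordered e e ∧ allB (ordered e) bt) ∧_) (allB-∧ (λ x → ordered x e) (λ x → allB (ordered x) bt) bt) ⟩
      (ordered e e ∧ allB (ordered e) bt) ∧ (allB (λ x → ordered x e) bt ∧ increasing bt) ∎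
    where open ≡-Reasoning

  greaterThan1 : ℕ → Bool
  greaterThan1 t = 1 <ᵇ t

  isSYT-ins1 : ∀ p bs us → p < length bs → suc (length us) ≡ length bs → allB greaterThan1 us ≡ true →
               isSYT bs (ins p 1 us) ≡ minimal (nth p bs) (del p bs) ∧ isSYT (del p bs) us
  isSYT-ins1 p bs us lt le h = begin
      distinct (ins p 1 us) ∧ increasing (zip bs (ins p 1 us))
        ≡⟨ cong₂ _∧_ (distinct-ins p 1 us) (cong increasing (zip-ins p bs us 1 lt le)) ⟩
      (allB (λ y → not (1 ≡ᵇ y)) us ∧ distinct us) ∧ increasing (ins p e bt)
        ≡⟨ cong₂ (λ a b → (a ∧ distinct us) ∧ b) new1 (increasing-ins p e bt) ⟩
      distinct us ∧ ((ordered e e ∧ allB (ordered e) bt) ∧ (allB (λ x → ordered x e) bt ∧ increasing bt))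
        ≡⟨ cong₂ (λ a c → distinct us ∧ (a ∧ (c ∧ increasing bt))) fromBox1 intoBox1 ⟩
      distinct us ∧ (minimal (nth p bs) (del p bs) ∧ increasing bt)
        ≡⟨ ∧-leftComm (distinct us) (minimal (nth p bs) (del p bs)) (increasing bt) ⟩
      minimal (nth p bs) (del p bs) ∧ (distinct us ∧ increasing bt) ∎
    where
    open ≡-Reasoning
    e = (nth p bs , 1)
    bt = zip (del p bs) us
    new1 : allB (λ y → not (1 ≡ᵇ y)) us ≡ true
    new1 = allB-impl greaterThan1 _ (λ { (suc (suc x)) _ → refl ; (suc zero) () ; zero () }) us h
    fromBox1 : (ordered e e ∧ allB (ordered e) bt) ≡ true
    fromBox1 rewrite successor-irrefl (nth p bs) =
      allB-impl (greaterThan1 ∘ proj₂) (ordered e)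
        (λ { (b' , suc (suc t)) _ → if-same (successor (nth p bs) b') ; (b' , suc zero) () ; (b' , zero) () })
        bt (allB-zip₂ greaterThan1 (del p bs) us h)
    intoBox1 : allB (λ x → ordered x e) bt ≡ minimal (nth p bs) (del p bs)
    intoBox1 = trans (into bt (allB-zip₂ greaterThan1 (del p bs) us h))
                     (allB-zip₁ (λ b' → not (successor b' (nth p bs))) (del p bs) us
                                (suc-injective (trans (length-del p bs lt) (sym le))))
      where
      into : ∀ xs → allB (greaterThan1 ∘ proj₂) xs ≡ true →
             allB (λ x → ordered x e) xs ≡ allB ((λ b' → not (successor b' (nth p bs))) ∘ proj₁) xs
      into [] _ = refl
      into ((b' , suc t) ∷ xs) hh = cong₂ _∧_ (if-not (successor b' (nth p bs)))
                                              (into xs (allB-tail (greaterThan1 ∘ proj₂) (b' , suc t) xs hh))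
      into ((b' , zero) ∷ xs) ()

  shift : Box × ℕ → Box × ℕ
  shift (b , t) = (b , suc t)

  distinct-suc : ∀ ts → distinct (map suc ts) ≡ distinct ts
  distinct-suc [] = refl
  distinct-suc (t ∷ ts) = cong₂ _∧_ (allB-map (λ y → not (suc t ≡ᵇ y)) suc ts) (distinct-suc ts)

  zip-suc : ∀ (bs : List Box) ts → zip bs (map suc ts) ≡ map shift (zip bs ts)
  zip-suc [] ts = refl
  zip-suc (b ∷ bs) [] = refl
  zip-suc (b ∷ bs) (t ∷ ts) = cong ((b , suc t) ∷_) (zip-suc bs ts)

  increasing-shift : ∀ bt → increasing (map shift bt) ≡ increasing bt
  increasing-shift bt = trans (allB-map (λ x → allB (ordered x) (map shift bt)) shift bt)
                              (allB-cong (λ x → allB-map (ordered (shift x)) shift bt) bt)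

  isSYT-suc : ∀ bs ts → isSYT bs (map suc ts) ≡ isSYT bs ts
  isSYT-suc bs ts = cong₂ _∧_ (distinct-suc ts) (trans (cong increasing (zip-suc bs ts)) (increasing-shift (zip bs ts)))

module FillingCount where

  open import Data.Bool using (Bool; true; false; _∧_)
  open import Data.Nat using (zero; _+_; _*_; _<_)
  open import Data.Nat.Properties using (≤-reflexive; suc-injective)
  open import Data.List using ([]; _∷_; map; length; upTo)
  open import Data.List.Properties using (map-upTo; length-map; length-upTo)
  open import Relation.Binary.PropositionalEquality
  open import Function using (_∘_)
  open Booleans using (allB-map; allB-true)
  open NatSums
  open LabelLists
  open Fillings

  labels : ℕ → List ℕ
  labels N = map suc (upTo N)

  cnt : List Box → ℕ
  cnt bs = Σℕ (λ ts → χ (isSYT bs ts)) (allLists (length bs) (labels (length bs)))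

  fSkew-cnt : ∀ μ la → fSkew μ la ≡ cnt (skewBoxes μ la)
  fSkew-cnt μ la = lenFilter (isSYT (skewBoxes μ la)) (allLists (length (skewBoxes μ la)) (labels (length (skewBoxes μ la))))

  cnt-length : ∀ D N → length D ≡ N → cnt D ≡ Σℕ (λ ts → χ (isSYT D ts)) (allLists N (labels N))
  cnt-length D N e = cong (λ n → Σℕ (λ ts → χ (isSYT D ts)) (allLists n (labels n))) e

  allLists-ext : ∀ k Y (P : ℕ → Bool) (H H' : List ℕ → ℕ) → allB P Y ≡ true →
    (∀ ts → length ts ≡ k → allB P ts ≡ true → H ts ≡ H' ts) → Σℕ H (allLists k Y) ≡ Σℕ H' (allLists k Y)
  allLists-ext zero Y P H H' hY h = cong (_+ 0) (h [] refl refl)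
  allLists-ext (suc k) Y P H H' hY h = begin
      Σℕ H (allLists (suc k) Y)
        ≡⟨ allLists-suc H k Y ⟩
      Σℕ (λ x → Σℕ (λ ts → H (x ∷ ts)) (allLists k Y)) Y
        ≡⟨ Σℕ-congB P (λ x px → allLists-ext k Y P (λ ts → H (x ∷ ts)) (λ ts → H' (x ∷ ts)) hY
                           (λ ts l a → h (x ∷ ts) (cong suc l) (trans (cong (_∧ allB P ts) px) a))) Y hY ⟩
      Σℕ (λ x → Σℕ (λ ts → H' (x ∷ ts)) (allLists k Y)) Y
        ≡⟨ sym (allLists-suc H' k Y) ⟩
      Σℕ H' (allLists (suc k) Y) ∎
    where open ≡-Reasoning

  allLists-map : ∀ k (f : ℕ → ℕ) X (H : List ℕ → ℕ) → Σℕ H (allLists k (map f X)) ≡ Σℕ (λ ts → H (map f ts)) (allLists k X)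
  allLists-map zero f X H = refl
  allLists-map (suc k) f X H = begin
      Σℕ H (allLists (suc k) (map f X))
        ≡⟨ allLists-suc H k (map f X) ⟩
      Σℕ (λ x → Σℕ (λ ts → H (x ∷ ts)) (allLists k (map f X))) (map f X)
        ≡⟨ Σℕ-map _ f X ⟩
      Σℕ (λ x → Σℕ (λ ts → H (f x ∷ ts)) (allLists k (map f X))) X
        ≡⟨ Σℕ-cong (λ x → allLists-map k f X (λ ts → H (f x ∷ ts))) X ⟩
      Σℕ (λ x → Σℕ (λ ts → H (f x ∷ map f ts)) (allLists k X)) X
        ≡⟨ sym (allLists-suc (λ ts → H (map f ts)) k X) ⟩
      Σℕ (λ ts → H (map f ts)) (allLists (suc k) X) ∎
    where open ≡-Reasoning

  labels-suc : ∀ N → labels (suc N) ≡ 1 ∷ map suc (labels N)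
  labels-suc N = cong (λ z → 1 ∷ map suc z) (sym (map-upTo suc N))

  length-labels : ∀ N → length (labels N) ≡ N
  length-labels N = trans (length-map suc (upTo N)) (length-upTo N)

  shiftedLabels>1 : ∀ N → allB greaterThan1 (map suc (labels N)) ≡ true
  shiftedLabels>1 N = trans (allB-map greaterThan1 suc (labels N))
                            (trans (allB-map (greaterThan1 ∘ suc) suc (upTo N)) (allB-true _ (λ _ → refl) (upTo N)))

  choiceSum : (Box → List Box → ℕ) → List Box → ℕ
  choiceSum G bs = Σr (length bs) (λ p → G (nth p bs) (del p bs))

  firstLabelAt : Box → List Box → ℕ
  firstLabelAt b R = χ (minimal b R) * cnt R

  -- the first-label recursion: split the label lists according to the position of 1;
  -- lists without 1 have a repeated entry (pigeonhole), and the rest shift down to label lists of del p bs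
  cnt-firstLabel : ∀ bs → 0 < length bs → cnt bs ≡ choiceSum firstLabelAt bs
  cnt-firstLabel (b ∷ bs) _ = begin
      cnt bs'
        ≡⟨ cong (λ z → Σℕ H (allLists (suc N) z)) (labels-suc N) ⟩
      Σℕ H (allLists (suc N) (1 ∷ Y))
        ≡⟨ Σ-allLists-insert 1 Y H repeatsVanish N ⟩
      Σℕ H (allLists (suc N) Y) + Σr (suc N) (λ p → Σℕ (λ us → H (ins p 1 us)) (allLists N Y))
        ≡⟨ cong₂ _+_ (Σ-allLists-pigeonhole Y (suc N) H repeatsVanish
                        (≤-reflexive (cong suc (trans (length-map suc (labels N)) (length-labels N)))))
                     (Σr-cong (suc N) label1At) ⟩
      0 + choiceSum firstLabelAt bs' ∎
    where
    open ≡-Reasoning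
    bs' = b ∷ bs
    N = length bs
    H : List ℕ → ℕ
    H ts = χ (isSYT bs' ts)
    Y = map suc (labels N)
    repeatsVanish : ∀ ts → distinct ts ≡ false → H ts ≡ 0
    repeatsVanish ts d rewrite d = refl
    label1At : ∀ p → p < suc N → Σℕ (λ us → H (ins p 1 us)) (allLists N Y) ≡ firstLabelAt (nth p bs') (del p bs')
    label1At p lt = begin
        Σℕ (λ us → H (ins p 1 us)) (allLists N Y)
          ≡⟨ allLists-ext N Y greaterThan1 _ (λ us → χ m * χ (isSYT D us)) (shiftedLabels>1 N)
               (λ us l a → trans (cong χ (isSYT-ins1 p bs' us lt (cong suc l) a)) (χ-∧ m (isSYT D us))) ⟩
        Σℕ (λ us → χ m * χ (isSYT D us)) (allLists N Y)
          ≡⟨ Σℕ-* (χ m) _ (allLists N Y) ⟩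
        χ m * Σℕ (λ us → χ (isSYT D us)) (allLists N Y)
          ≡⟨ cong (χ m *_) (allLists-map N suc (labels N) (λ us → χ (isSYT D us))) ⟩
        χ m * Σℕ (λ us → χ (isSYT D (map suc us))) (allLists N (labels N))
          ≡⟨ cong (χ m *_) (Σℕ-cong (λ us → cong χ (isSYT-suc D us)) (allLists N (labels N))) ⟩
        χ m * Σℕ (λ us → χ (isSYT D us)) (allLists N (labels N))
          ≡⟨ cong (χ m *_) (sym (cnt-length D N (suc-injective (length-del p bs' lt)))) ⟩
        χ m * cnt D ∎
      where
      m = minimal (nth p bs') (del p bs')
      D = del p bs'

module Diagrams where

  open import Data.Bool using (true; false; _∧_)
  open import Data.Nat using (zero; _+_; _<_; z≤n; s≤s; _≤ᵇ_)
  open import Data.Nat.Properties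
  open import Data.Bool.Properties using (∧-zeroʳ)
  open import Data.List using ([]; _∷_; length; foldr)
  open import Data.Product using (_,_; proj₁; proj₂)
  open import Data.Empty using (⊥-elim)
  open import Relation.Binary.PropositionalEquality
  open Booleans using (∧-split; ≤ᵇ-true; ≤-≤ᵇ)

  row-beyond : ∀ l r → length l ≤ r → row l r ≡ 0
  row-beyond [] r _ = refl
  row-beyond (a ∷ l) (suc r) (s≤s le) = row-beyond l r le

  row-pos : ∀ l r → 0 < row l r → r < length l
  row-pos [] r ()
  row-pos (a ∷ l) zero _ = s≤s z≤n
  row-pos (a ∷ l) (suc r) p = s≤s (row-pos l r p)

  isPart-tail : ∀ a l → isPart (a ∷ l) ≡ true → isPart l ≡ true
  isPart-tail a [] e = refl
  isPart-tail a (b ∷ l) e = proj₂ (∧-split _ _ e)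

  isPart-pos : ∀ a l → isPart (a ∷ l) ≡ true → 1 ≤ a
  isPart-pos a [] e = ≤ᵇ-true 1 a e
  isPart-pos a (b ∷ l) e = ≤-trans (isPart-pos b l (proj₂ (∧-split _ _ e))) (≤ᵇ-true b a (proj₁ (∧-split _ _ e)))

  isPart-mono : ∀ l → isPart l ≡ true → ∀ r → row l (suc r) ≤ row l r
  isPart-mono [] e r = z≤n
  isPart-mono (a ∷ []) e zero = z≤n
  isPart-mono (a ∷ []) e (suc r) = z≤n
  isPart-mono (a ∷ b ∷ l) e zero = ≤ᵇ-true b a (proj₁ (∧-split _ _ e))
  isPart-mono (a ∷ b ∷ l) e (suc r) = isPart-mono (b ∷ l) (proj₂ (∧-split _ _ e)) r

  row-incAt-same : ∀ i l → row (incAt i l) i ≡ suc (row l i)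
  row-incAt-same zero [] = refl
  row-incAt-same zero (a ∷ l) = refl
  row-incAt-same (suc i) [] = row-incAt-same i []
  row-incAt-same (suc i) (a ∷ l) = row-incAt-same i l

  row-incAt-other : ∀ i l j → i ≢ j → row (incAt i l) j ≡ row l j
  row-incAt-other zero [] zero ne = ⊥-elim (ne refl)
  row-incAt-other zero [] (suc j) ne = refl
  row-incAt-other zero (a ∷ l) zero ne = ⊥-elim (ne refl)
  row-incAt-other zero (a ∷ l) (suc j) ne = refl
  row-incAt-other (suc i) [] zero ne = refl
  row-incAt-other (suc i) [] (suc j) ne = row-incAt-other i [] j (λ e → ne (cong suc e))
  row-incAt-other (suc i) (a ∷ l) zero ne = refl
  row-incAt-other (suc i) (a ∷ l) (suc j) ne = row-incAt-other i l j (λ e → ne (cong suc e))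

  sizeL : List ℕ → ℕ
  sizeL = foldr _+_ 0

  size-incAt : ∀ i l → sizeL (incAt i l) ≡ suc (sizeL l)
  size-incAt zero [] = refl
  size-incAt zero (a ∷ l) = refl
  size-incAt (suc i) [] = size-incAt i []
  size-incAt (suc i) (a ∷ l) = trans (cong (a +_) (size-incAt i l)) (+-suc a (sizeL l))

  isPart-incAt0 : ∀ l → isPart l ≡ true → isPart (incAt 0 l) ≡ true
  isPart-incAt0 [] e = refl
  isPart-incAt0 (a ∷ []) e = refl
  isPart-incAt0 (a ∷ b ∷ l) e
    rewrite ≤-≤ᵇ (m≤n⇒m≤1+n (≤ᵇ-true b a (proj₁ (∧-split (b ≤ᵇ a) (isPart (b ∷ l)) e)))) =
    proj₂ (∧-split (b ≤ᵇ a) (isPart (b ∷ l)) e)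

  isPart-incAt-suc : ∀ l r → isPart l ≡ true → suc r ≤ length l → row l (suc r) < row l r →
                     isPart (incAt (suc r) l) ≡ true
  isPart-incAt-suc (a ∷ []) zero e le lt rewrite ≤-≤ᵇ (isPart-pos a [] e) = refl
  isPart-incAt-suc (a ∷ b ∷ l) zero e le lt rewrite ≤-≤ᵇ lt = isPart-incAt0 (b ∷ l) (proj₂ (∧-split _ _ e))
  isPart-incAt-suc (a ∷ b ∷ l) (suc r) e (s≤s le) lt rewrite proj₁ (∧-split (b ≤ᵇ a) (isPart (b ∷ l)) e) =
    isPart-incAt-suc (b ∷ l) r (proj₂ (∧-split (b ≤ᵇ a) (isPart (b ∷ l)) e)) le lt
  isPart-incAt-suc (a ∷ []) (suc r) e (s≤s ()) lt

  incAt-cons : ∀ i l → ∃ λ y → ∃ λ rest → incAt i l ≡ y ∷ rest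
  incAt-cons zero [] = 1 , [] , refl
  incAt-cons zero (a ∷ l) = suc a , l , refl
  incAt-cons (suc i) [] = 0 , incAt i [] , refl
  incAt-cons (suc i) (a ∷ l) = a , incAt i l , refl

  isPart-cons-false : ∀ a l → isPart l ≡ false → (∃ λ y → ∃ λ rest → l ≡ y ∷ rest) → isPart (a ∷ l) ≡ false
  isPart-cons-false a .(y ∷ rest) e (y , rest , refl) = trans (cong ((y ≤ᵇ a) ∧_) e) (∧-zeroʳ _)

  isPart-incAt-far : ∀ l i → length l < i → isPart (incAt i l) ≡ false
  isPart-incAt-far [] (suc zero) lt = refl
  isPart-incAt-far [] (suc (suc i)) lt =
    isPart-cons-false 0 (incAt (suc i) []) (isPart-incAt-far [] (suc i) (s≤s z≤n)) (incAt-cons (suc i) [])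
  isPart-incAt-far (a ∷ l) (suc i) (s≤s lt) = isPart-cons-false a (incAt i l) (isPart-incAt-far l i lt) (incAt-cons i l)

  sizeMono : ∀ m l → (∀ r → row m r ≤ row l r) → sizeL m ≤ sizeL l
  sizeMono [] l h = z≤n
  sizeMono (a ∷ m) [] h = ≤-reflexive (zeroSum (a ∷ m) h)
    where
    zeroSum : ∀ m → (∀ r → row m r ≤ row [] r) → sizeL m ≡ 0
    zeroSum [] h = refl
    zeroSum (a ∷ m) h = cong₂ _+_ (n≤0⇒n≡0 (h 0)) (zeroSum m (λ r → h (suc r)))
  sizeMono (a ∷ m) (b ∷ l) h = +-mono-≤ (h 0) (sizeMono m l (λ r → h (suc r)))

  sizeZero : ∀ l → sizeL l ≡ 0 → ∀ r → row l r ≡ 0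
  sizeZero [] e r = refl
  sizeZero (a ∷ l) e zero = m+n≡0⇒m≡0 a e
  sizeZero (a ∷ l) e (suc r) = sizeZero l (m+n≡0⇒n≡0 a e) r

  sizeEq : ∀ m l → (∀ r → row m r ≤ row l r) → sizeL m ≡ sizeL l → ∀ r → row m r ≡ row l r
  sizeEq [] l h e r = sym (sizeZero l (sym e) r)
  sizeEq (a ∷ m) [] h e r = sizeZero (a ∷ m) e r
  sizeEq (a ∷ m) (b ∷ l) h e = rows
    where
    a≡b : a ≡ b
    a≡b = ≤-antisym (h 0) (+-cancelʳ-≤ (sizeL l) b a
                             (≤-trans (≤-reflexive (sym e)) (+-monoʳ-≤ a (sizeMono m l (λ r → h (suc r))))))
    rows : ∀ r → row (a ∷ m) r ≡ row (b ∷ l) r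
    rows zero = a≡b
    rows (suc r) = sizeEq m l (λ r → h (suc r)) (+-cancelˡ-≡ a (sizeL m) (sizeL l) (trans e (cong (_+ sizeL l) (sym a≡b)))) r

  partEq : ∀ m l → isPart m ≡ true → isPart l ≡ true → (∀ r → row m r ≡ row l r) → m ≡ l
  partEq [] [] _ _ h = refl
  partEq [] (b ∷ l) _ el h = ⊥-elim (<⇒≢ (isPart-pos b l el) (h 0))
  partEq (a ∷ m) [] em _ h = ⊥-elim (<⇒≢ (isPart-pos a m em) (sym (h 0)))
  partEq (a ∷ m) (b ∷ l) em el h = cong₂ _∷_ (h 0) (partEq m l (isPart-tail a m em) (isPart-tail b l el) (λ r → h (suc r)))

module SkewBoxes where

  open import Data.Bool using (if_then_else_)
  open import Data.Nat using (zero; _+_; _∸_; _<_; z≤n; s≤s; _≡ᵇ_; _≟_; _≤?_)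
  open import Data.Nat.Properties
  open import Data.List using ([]; _∷_; _++_; length; concatMap; upTo)
  open import Data.List.Properties using (upTo-∷ʳ; concatMap-++; ++-identityʳ)
  open import Data.List.Membership.Propositional using (_∈_; lose; find)
  open import Data.List.Membership.Propositional.Properties using (∈-upTo⁺; ∈-upTo⁻; ∈-concatMap⁺; ∈-concatMap⁻)
  open import Data.List.Relation.Unary.Any using (here; there)
  open import Data.Product using (_,_)
  open import Data.Empty using (⊥-elim)
  open import Relation.Nullary using (yes; no)
  open import Relation.Binary.PropositionalEquality
  open Booleans using (≡ᵇ-refl; ≡ᵇ-false)
  open NatSums
  open Fillings using (Box; nth; del)
  open FillingCount using (choiceSum)

  rowSegment : List ℕ → List ℕ → ℕ → List Box
  rowSegment m l i = rowBoxes i (row m i) (row l i ∸ row m i)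

  skewB : List ℕ → List ℕ → List Box
  skewB m l = concatMap (rowSegment m l) (upTo (length l))

  rowBoxes-∈⁻ : ∀ i a k {r c} → (r , c) ∈ rowBoxes i a k → r ≡ i × a ≤ c × c < a + k
  rowBoxes-∈⁻ i a (suc k) (here refl) = refl , ≤-refl , m<m+n a (s≤s z≤n)
  rowBoxes-∈⁻ i a (suc k) {r} {c} (there mem) with rowBoxes-∈⁻ i (suc a) k mem
  ... | e , le , lt = e , <⇒≤ le , subst (c <_) (sym (+-suc a k)) lt

  rowBoxes-∈⁺ : ∀ i a k c → a ≤ c → c < a + k → (i , c) ∈ rowBoxes i a k
  rowBoxes-∈⁺ i a zero c le lt = ⊥-elim (<⇒≱ (subst (c <_) (+-identityʳ a) lt) le)
  rowBoxes-∈⁺ i a (suc k) c le lt with c ≟ a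
  ... | yes refl = here refl
  ... | no ne = there (rowBoxes-∈⁺ i (suc a) k c (≤∧≢⇒< le (λ e → ne (sym e))) (subst (c <_) (+-suc a k) lt))

  <-truncated : ∀ a c L → a ≤ c → c < a + (L ∸ a) → c < L
  <-truncated a c L le lt with a ≤? L
  ... | yes aL = subst (c <_) (m+[n∸m]≡n aL) lt
  ... | no naL = ⊥-elim (<⇒≱ (subst (c <_) (trans (cong (a +_) (m≤n⇒m∸n≡0 (<⇒≤ (≰⇒> naL)))) (+-identityʳ a)) lt) le)

  skewB-∈⁻ : ∀ m l {r c} → (r , c) ∈ skewB m l → r < length l × row m r ≤ c × c < row l r
  skewB-∈⁻ m l mem with find (∈-concatMap⁻ (rowSegment m l) {xs = upTo (length l)} mem)
  ... | j , jm , rm with rowBoxes-∈⁻ j (row m j) (row l j ∸ row m j) rm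
  ... | refl , le , lt = ∈-upTo⁻ jm , le , <-truncated (row m j) _ (row l j) le lt

  skewB-∈⁺ : ∀ m l {r c} → r < length l → row m r ≤ c → c < row l r → (r , c) ∈ skewB m l
  skewB-∈⁺ m l {r} {c} lt le lt2 =
    ∈-concatMap⁺ (rowSegment m l)
      (lose (∈-upTo⁺ lt) (rowBoxes-∈⁺ r (row m r) (row l r ∸ row m r) c le
                            (subst (c <_) (sym (m+[n∸m]≡n (≤-trans le (<⇒≤ lt2)))) lt2)))

  choiceSum-cong : ∀ {G G' : Box → List Box → ℕ} → (∀ b r → G b r ≡ G' b r) → ∀ bs → choiceSum G bs ≡ choiceSum G' bs
  choiceSum-cong e bs = Σr-cong (length bs) (λ p _ → e (nth p bs) (del p bs))

  choiceSum-++ : ∀ G xs ys → choiceSum G (xs ++ ys) ≡ choiceSum (λ b r → G b (r ++ ys)) xs + choiceSum (λ b r → G b (xs ++ r)) ys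
  choiceSum-++ G [] ys = refl
  choiceSum-++ G (x ∷ xs) ys = trans (cong (G x (xs ++ ys) +_) (choiceSum-++ (λ b r → G b (x ∷ r)) xs ys)) (sym (+-assoc (G x (xs ++ ys)) _ _))

  concatMap-upTo-suc : ∀ {B : Set} (f : ℕ → List B) n → concatMap f (upTo (suc n)) ≡ concatMap f (upTo n) ++ f n
  concatMap-upTo-suc f n = trans (cong (concatMap f) (sym (upTo-∷ʳ n)))
                             (trans (concatMap-++ f (upTo n) (n ∷ [])) (cong (concatMap f (upTo n) ++_) (++-identityʳ (f n))))

  concatMap-upTo-cong : ∀ {B : Set} n (f g : ℕ → List B) → (∀ j → j < n → f j ≡ g j) → concatMap f (upTo n) ≡ concatMap g (upTo n)
  concatMap-upTo-cong zero f g e = refl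
  concatMap-upTo-cong (suc n) f g e =
    trans (concatMap-upTo-suc f n)
          (trans (cong₂ _++_ (concatMap-upTo-cong n f g (λ j lt → e j (m≤n⇒m≤1+n lt))) (e n ≤-refl))
                 (sym (concatMap-upTo-suc g n)))

  replaceAt : {B : Set} → (ℕ → List B) → ℕ → List B → ℕ → List B
  replaceAt ρ i r j = if j ≡ᵇ i then r else ρ j

  replaceAt-same : ∀ {B : Set} (ρ : ℕ → List B) i r → replaceAt ρ i r i ≡ r
  replaceAt-same ρ i r rewrite ≡ᵇ-refl i = refl

  replaceAt-other : ∀ {B : Set} (ρ : ℕ → List B) i r j → j ≢ i → replaceAt ρ i r j ≡ ρ j
  replaceAt-other ρ i r j ne rewrite ≡ᵇ-false j i ne = refl

  choiceSum-concat : ∀ (ρ : ℕ → List Box) n G → choiceSum G (concatMap ρ (upTo n)) ≡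
                Σr n (λ i → choiceSum (λ b r → G b (concatMap (replaceAt ρ i r) (upTo n))) (ρ i))
  choiceSum-concat ρ zero G = refl
  choiceSum-concat ρ (suc n) G = begin
      choiceSum G (concatMap ρ (upTo (suc n)))
        ≡⟨ cong (choiceSum G) (concatMap-upTo-suc ρ n) ⟩
      choiceSum G (Cc ++ ρ n)
        ≡⟨ choiceSum-++ G Cc (ρ n) ⟩
      choiceSum (λ b r → G b (r ++ ρ n)) Cc + choiceSum (λ b r → G b (Cc ++ r)) (ρ n)
        ≡⟨ cong₂ _+_ (trans (choiceSum-concat ρ n (λ b r → G b (r ++ ρ n)))
                            (Σr-cong n (λ i lt → choiceSum-cong (λ b r → cong (G b) (earlier i lt r)) (ρ i))))
                     (choiceSum-cong (λ b r → cong (G b) (last r)) (ρ n)) ⟩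
      Σr n F + F n
        ≡⟨ sym (Σr-last n F) ⟩
      Σr (suc n) F ∎
    where
    open ≡-Reasoning
    Cc = concatMap ρ (upTo n)
    F : ℕ → ℕ
    F i = choiceSum (λ b r → G b (concatMap (replaceAt ρ i r) (upTo (suc n)))) (ρ i)
    earlier : ∀ i → i < n → ∀ r → concatMap (replaceAt ρ i r) (upTo n) ++ ρ n ≡ concatMap (replaceAt ρ i r) (upTo (suc n))
    earlier i lt r = sym (trans (concatMap-upTo-suc (replaceAt ρ i r) n)
                                (cong (concatMap (replaceAt ρ i r) (upTo n) ++_) (replaceAt-other ρ i r n (λ e → <⇒≢ lt (sym e)))))
    last : ∀ r → Cc ++ r ≡ concatMap (replaceAt ρ n r) (upTo (suc n))
    last r = sym (trans (concatMap-upTo-suc (replaceAt ρ n r) n)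
                        (cong₂ _++_ (concatMap-upTo-cong n (replaceAt ρ n r) ρ (λ j lt → replaceAt-other ρ n r j (<⇒≢ lt)))
                                    (replaceAt-same ρ n r)))

-- In a standard filling of λ/μ the label 1 sits in a minimal box; within
-- row i only the first box (i , μ_i) can be minimal, and it is minimal exactly
-- when μ + (box in row i) is again a partition; removing it leaves the skew
-- shape λ/(μ + box).
module SkewRecursion where

  open import Data.Bool using (true; false; not)
  open import Data.Nat using (zero; _+_; _*_; _∸_; _<_; z≤n; s≤s; pred; _<ᵇ_; _≟_; _≤?_; _<?_)
  open import Data.Nat.Properties
  open import Data.List using ([]; _∷_; length; concatMap; upTo)
  open import Data.List.Membership.Propositional using (_∈_; lose)
  open import Data.List.Membership.Propositional.Properties using (∈-upTo⁺; ∈-concatMap⁺)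
  open import Data.List.Relation.Unary.Any using (here; there)
  open import Data.Product using (_,_)
  open import Data.Sum using (inj₁; inj₂)
  open import Data.Empty using (⊥; ⊥-elim)
  open import Relation.Nullary using (yes; no)
  open import Relation.Binary.PropositionalEquality
  open Booleans
  open NatSums
  open Fillings using (Box; successor; minimal)
  open FillingCount using (cnt; choiceSum; firstLabelAt; cnt-firstLabel)
  open Diagrams
  open SkewBoxes

  laterBoxesNotMinimal : ∀ k i a (Ctx : List Box → List Box) → (∀ x r → x ∈ r → x ∈ Ctx r) →
    choiceSum (λ b r → firstLabelAt b (Ctx ((i , a) ∷ r))) (rowBoxes i (suc a) k) ≡ 0
  laterBoxesNotMinimal zero i a Ctx h = refl
  laterBoxesNotMinimal (suc k) i a Ctx h =
    cong₂ _+_ first (laterBoxesNotMinimal k i (suc a) (λ r → Ctx ((i , a) ∷ r)) (λ x r mem → h x ((i , a) ∷ r) (there mem)))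
    where
    leftNeighbour : successor (i , a) (i , suc a) ≡ true
    leftNeighbour rewrite ≡ᵇ-refl i | ≡ᵇ-refl a = refl
    first : firstLabelAt (i , suc a) (Ctx ((i , a) ∷ rowBoxes i (suc (suc a)) k)) ≡ 0
    first rewrite allB-∈⁻ (λ b' → not (successor b' (i , suc a))) (Ctx ((i , a) ∷ rowBoxes i (suc (suc a)) k))
                    (h (i , a) _ (here refl)) (cong not leftNeighbour) = refl

  module _ (m l : List ℕ) (pm : isPart m ≡ true) (pl : isPart l ≡ true) (sub : ∀ r → row m r ≤ row l r) where

    withRow : ℕ → List Box → List Box
    withRow i r = concatMap (replaceAt (rowSegment m l) i r) (upTo (length l))

    withRow-⊇ : ∀ i → i < length l → ∀ x r → x ∈ r → x ∈ withRow i r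
    withRow-⊇ i lt x r mem =
      ∈-concatMap⁺ (replaceAt (rowSegment m l) i r)
        (lose (∈-upTo⁺ lt) (subst (x ∈_) (sym (replaceAt-same (rowSegment m l) i r)) mem))

    withRow-tail : ∀ i k → i < length l → row l i ∸ row m i ≡ suc k →
                   withRow i (rowBoxes i (suc (row m i)) k) ≡ skewB (incAt i m) l
    withRow-tail i k lt eq = concatMap-upTo-cong (length l) _ _ perRow
      where
      perRow : ∀ j → j < length l → replaceAt (rowSegment m l) i (rowBoxes i (suc (row m i)) k) j ≡ rowSegment (incAt i m) l j
      perRow j _ with j ≟ i
      ... | yes refl rewrite replaceAt-same (rowSegment m l) j (rowBoxes j (suc (row m j)) k) | row-incAt-same j m =
            cong (rowBoxes j (suc (row m j))) (sym (trans (sym (pred[m∸n]≡m∸[1+n] (row l j) (row m j))) (cong pred eq)))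
      ... | no ne rewrite replaceAt-other (rowSegment m l) i (rowBoxes i (suc (row m i)) k) j ne
                        | row-incAt-other i m j (λ e → ne (sym e)) = refl

    -- if μ + (box in row i) is not a partition then i = r+1 with μ_r = μ_{r+1}, and the box
    -- (r , μ_{r+1}) of λ/μ lies directly above (i , μ_i), which is therefore not minimal
    notPartition⇒notMinimal : ∀ i → i < length l → row m i < row l i → isPart (incAt i m) ≡ false →
                              minimal (i , row m i) (skewB (incAt i m) l) ≡ false
    notPartition⇒notMinimal zero lt mlt e = ⊥-elim (false≢true (trans (sym e) (isPart-incAt0 m pm)))
    notPartition⇒notMinimal (suc r) lt mlt e with row m r ≤? row m (suc r)
    ... | yes le = allB-∈⁻ (λ b' → not (successor b' (suc r , row m (suc r)))) (skewB (incAt (suc r) m) l) above (cong not below)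
      where
      above : (r , row m (suc r)) ∈ skewB (incAt (suc r) m) l
      above = skewB-∈⁺ (incAt (suc r) m) l (<-trans (n<1+n r) lt) (≤-trans (≤-reflexive (row-incAt-other (suc r) m r (λ ()))) le)
                       (<-≤-trans mlt (isPart-mono l pl r))
      below : successor (r , row m (suc r)) (suc r , row m (suc r)) ≡ true
      below rewrite ≡ᵇ-refl r | ≡ᵇ-refl (row m (suc r)) = ∨-true _
    ... | no nle = ⊥-elim (false≢true (trans (sym e)
                     (isPart-incAt-suc m r pm (row-pos m r (≤-trans (s≤s z≤n) (≰⇒> nle))) (≰⇒> nle))))

    -- if μ' = μ + (box in row i) is a partition, neither the left neighbour nor the
    -- box above (i , μ_i) lies in λ/μ'
    partition⇒minimal : ∀ i → isPart (incAt i m) ≡ true → minimal (i , row m i) (skewB (incAt i m) l) ≡ true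
    partition⇒minimal i pp = allB-∈⁺ _ (skewB (incAt i m) l) (λ x mem → cong not (not-true (noPredecessor x mem)))
      where
      m' = incAt i m
      noPredecessor : ∀ x → x ∈ skewB m' l → successor x (i , row m i) ≡ true → ⊥
      noPredecessor (r , c) mem e with skewB-∈⁻ m' l mem | ∨-split _ _ e
      ... | _ , le , _ | inj₁ left with ∧-split _ _ left
      ...   | e1 , e2 = <-irrefl refl (≤-trans (n≤1+n (suc c)) (≤-trans (≤-reflexive (sym rowLength)) le))
        where
        rowLength : row m' r ≡ suc (suc c)
        rowLength = trans (cong (row m') (sym (≡ᵇ-true i r e1))) (trans (row-incAt-same i m) (cong suc (≡ᵇ-true (row m i) (suc c) e2)))
      noPredecessor (r , c) mem e | _ , le , _ | inj₂ up with ∧-split _ _ up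
      ...   | e1 , e2 with ≡ᵇ-true i (suc r) e1 | ≡ᵇ-true (row m i) c e2
      ...     | refl | refl = <-irrefl refl (≤-trans (≤-trans (≤-reflexive (sym (row-incAt-same (suc r) m))) (isPart-mono m' pp r)) le)

    firstBoxMinimal : ∀ i → i < length l → row m i < row l i → minimal (i , row m i) (skewB (incAt i m) l) ≡ isPart (incAt i m)
    firstBoxMinimal i lt mlt = bool-ext toPart (partition⇒minimal i)
      where
      toPart : minimal (i , row m i) (skewB (incAt i m) l) ≡ true → isPart (incAt i m) ≡ true
      toPart h with isPart (incAt i m) in e
      ... | true = refl
      ... | false = trans (sym (notPartition⇒notMinimal i lt mlt e)) h

    rowContribution : ℕ → ℕ
    rowContribution i = χ (isPart (incAt i m)) * (χ (row m i <ᵇ row l i) * cnt (skewB (incAt i m) l))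

    -- within row i only the first box can carry the label 1
    rowSum : ∀ i k → i < length l → row l i ∸ row m i ≡ k →
             choiceSum (λ b r → firstLabelAt b (withRow i r)) (rowBoxes i (row m i) k) ≡ rowContribution i
    rowSum i zero lt eq rewrite <ᵇ-false (row m i) (row l i) (m∸n≡0⇒m≤n eq) = sym (*-zeroʳ (χ (isPart (incAt i m))))
    rowSum i (suc k) lt eq = begin
        firstLabelAt (i , row m i) (withRow i (rowBoxes i (suc (row m i)) k))
          + choiceSum (λ b r → firstLabelAt b (withRow i ((i , row m i) ∷ r))) (rowBoxes i (suc (row m i)) k)
          ≡⟨ cong₂ _+_ (cong (firstLabelAt (i , row m i)) (withRow-tail i k lt eq))
                       (laterBoxesNotMinimal k i (row m i) (withRow i) (withRow-⊇ i lt)) ⟩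
        χ (minimal (i , row m i) (skewB m' l)) * cnt (skewB m' l) + 0
          ≡⟨ trans (+-identityʳ _) (cong (λ z → χ z * cnt (skewB m' l)) (firstBoxMinimal i lt mlt)) ⟩
        χ (isPart m') * cnt (skewB m' l)
          ≡⟨ cong (χ (isPart m') *_) (sym (*-identityˡ (cnt (skewB m' l)))) ⟩
        χ (isPart m') * (1 * cnt (skewB m' l))
          ≡⟨ cong (λ z → χ (isPart m') * (χ z * cnt (skewB m' l))) (sym (<-<ᵇ mlt)) ⟩
        rowContribution i ∎
      where
      open ≡-Reasoning
      m' = incAt i m
      mlt : row m i < row l i
      mlt with row m i <? row l i
      ... | yes p = p
      ... | no np = ⊥-elim (0≢1+n (trans (sym (m≤n⇒m∸n≡0 (≮⇒≥ np))) eq))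

    -- a proper containment leaves some box: otherwise every row of λ fits in μ
    nonempty : sizeL m < sizeL l → 0 < length (skewB m l)
    nonempty slt with skewB m l in eq
    ... | b ∷ bs = s≤s z≤n
    ... | [] = ⊥-elim (<⇒≱ slt (sizeMono l m rowsBelow))
      where
      rowsBelow : ∀ r → row l r ≤ row m r
      rowsBelow r with r <? length l
      ... | no nlt = subst (_≤ row m r) (sym (row-beyond l r (≮⇒≥ nlt))) z≤n
      ... | yes rl with row m r <? row l r
      ...   | no nl = ≮⇒≥ nl
      ...   | yes ml with subst ((r , row m r) ∈_) eq (skewB-∈⁺ m l rl ≤-refl ml)
      ...     | ()

    -- the first-label recursion grouped by rows; rows beyond λ or beyond the row under μ contribute 0
    cnt-recursion : sizeL m < sizeL l → cnt (skewB m l) ≡ Σr (suc (length m)) rowContribution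
    cnt-recursion slt = begin
        cnt (skewB m l)
          ≡⟨ cnt-firstLabel (skewB m l) (nonempty slt) ⟩
        choiceSum firstLabelAt (skewB m l)
          ≡⟨ choiceSum-concat (rowSegment m l) (length l) firstLabelAt ⟩
        Σr (length l) (λ i → choiceSum (λ b r → firstLabelAt b (withRow i r)) (rowSegment m l i))
          ≡⟨ Σr-cong (length l) (λ i lt → rowSum i _ lt refl) ⟩
        Σr (length l) rowContribution
          ≡⟨ sym (Σr-extend (length l) (suc (length m)) rowContribution beyondλ) ⟩
        Σr (length l + suc (length m)) rowContribution
          ≡⟨ cong (λ z → Σr z rowContribution) (+-comm (length l) (suc (length m))) ⟩
        Σr (suc (length m) + length l) rowContribution
          ≡⟨ Σr-extend (suc (length m)) (length l) rowContribution beyondμ ⟩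
        Σr (suc (length m)) rowContribution ∎
      where
      open ≡-Reasoning
      beyondλ : ∀ i → length l ≤ i → rowContribution i ≡ 0
      beyondλ i le rewrite row-beyond l i le = *-zeroʳ (χ (isPart (incAt i m)))
      beyondμ : ∀ i → suc (length m) ≤ i → rowContribution i ≡ 0
      beyondμ i le rewrite isPart-incAt-far m i le = refl

module SkewCount where

  open import Data.Bool using (Bool; true; false; T; T?)
  open import Data.Bool.Properties using (T-irrelevant)
  open import Data.Nat using (_*_; _<_; z≤n; _≟_; _<?_; _≤ᵇ_; _<ᵇ_)
  open import Data.Nat.Properties using (≮⇒≥; n∸n≡0)
  open import Data.List using ([]; _∷_; length; concatMap; upTo)
  open import Data.List.Membership.Propositional using (_∈_; find)
  open import Data.List.Membership.Propositional.Properties using (∈-upTo⁺; ∈-concatMap⁻)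
  open import Data.List.Relation.Unary.Any using (here)
  open import Data.Product using (Σ; _,_; proj₁)
  open import Data.Empty using (⊥-elim)
  open import Relation.Nullary using (yes; no)
  open import Relation.Binary.PropositionalEquality
  open Booleans
  open NatSums
  open FillingCount using (cnt; fSkew-cnt)
  open Diagrams
  open SkewBoxes using (rowSegment; skewB; concatMap-upTo-cong)
  open SkewRecursion using (rowContribution; cnt-recursion)

  -- decidable containment of Young diagrams (rows beyond μ are trivially contained)
  contained : Partition → Partition → Bool
  contained (m , _) (l , _) = allB (λ r → row m r ≤ᵇ row l r) (upTo (length m))

  contained-sound : ∀ μ la → contained μ la ≡ true → μ ⊆ₚ la
  contained-sound (m , _) (l , _) e r with r <? length m
  ... | yes lt = ≤ᵇ-true _ _ (allB-∈ (λ r → row m r ≤ᵇ row l r) (upTo (length m)) e (∈-upTo⁺ lt))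
  ... | no nlt = subst (_≤ row l r) (sym (row-beyond m r (≮⇒≥ nlt))) z≤n

  contained-complete : ∀ μ la → μ ⊆ₚ la → contained μ la ≡ true
  contained-complete (m , _) (l , _) h = allB-∈⁺ _ (upTo (length m)) (λ r _ → ≤-≤ᵇ (h r))

  contained-incAt : ∀ i m p l q → (∀ r → row m r ≤ row l r) → contained (incAt i m , p) (l , q) ≡ (row m i <ᵇ row l i)
  contained-incAt i m p l q sub = bool-ext toLt fromLt
    where
    toLt : contained (incAt i m , p) (l , q) ≡ true → (row m i <ᵇ row l i) ≡ true
    toLt e = <-<ᵇ (subst (_≤ row l i) (row-incAt-same i m) (contained-sound (incAt i m , p) (l , q) e i))
    fromLt : (row m i <ᵇ row l i) ≡ true → contained (incAt i m , p) (l , q) ≡ true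
    fromLt e = contained-complete (incAt i m , p) (l , q) rows
      where
      rows : ∀ r → row (incAt i m) r ≤ row l r
      rows r with r ≟ i
      ... | yes refl = subst (_≤ row l r) (sym (row-incAt-same r m)) (<ᵇ-true _ _ e)
      ... | no ne = subst (_≤ row l r) (sym (row-incAt-other i m r (λ e → ne (sym e)))) (sub r)

  asPartition-true : ∀ l → isPart l ≡ true → Σ (T (isPart l)) (λ p → asPartition l ≡ (l , p) ∷ [])
  asPartition-true l e with T? (isPart l)
  ... | yes p = p , refl
  ... | no np = ⊥-elim (np (toT e))

  asPartition-false : ∀ l → isPart l ≡ false → asPartition l ≡ []
  asPartition-false l e with T? (isPart l)
  ... | yes p = ⊥-elim (false≢true (trans (sym e) (fromT p)))
  ... | no np = refl

  asPartition-∈ : ∀ l x → x ∈ asPartition l → proj₁ x ≡ l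
  asPartition-∈ l x mem with T? (isPart l)
  asPartition-∈ l x (here refl) | yes p = refl

  plusBoxes-∈ : ∀ μ x → x ∈ plusBoxes μ → ∃ λ i → proj₁ x ≡ incAt i (proj₁ μ)
  plusBoxes-∈ (m , _) x mem with find (∈-concatMap⁻ (λ i → asPartition (incAt i m)) {xs = upTo (suc (length m))} mem)
  ... | i , _ , xm = i , asPartition-∈ (incAt i m) x xm

  partition-≡ : ∀ (x y : Partition) → proj₁ x ≡ proj₁ y → x ≡ y
  partition-≡ (l , p) (.l , q) refl = cong (l ,_) (T-irrelevant p q)

  -- f_{λ/μ} = Σ_{μ⁺} [μ⁺ ⊆ λ] f_{λ/μ⁺}, the row-i term of cnt-recursion being the term for μ⁺ = μ + (box in row i)
  fSkew-recursion : ∀ (μ la : Partition) → μ ⊆ₚ la → size μ < size la →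
                    fSkew μ la ≡ Σℕ (λ μ⁺ → χ (contained μ⁺ la) * fSkew μ⁺ la) (plusBoxes μ)
  fSkew-recursion (m , pm) (l , pl) sub slt = begin
      fSkew (m , pm) (l , pl)
        ≡⟨ fSkew-cnt (m , pm) (l , pl) ⟩
      cnt (skewB m l)
        ≡⟨ cnt-recursion m l (fromT pm) (fromT pl) sub slt ⟩
      Σr (suc (length m)) (rowContribution m l (fromT pm) (fromT pl) sub)
        ≡⟨ Σr-cong (suc (length m)) (λ i _ → sym (rowTerm i)) ⟩
      Σr (suc (length m)) (λ i → Σℕ F (asPartition (incAt i m)))
        ≡⟨ sym (Σℕ-upTo _ (suc (length m))) ⟩
      Σℕ (λ i → Σℕ F (asPartition (incAt i m))) (upTo (suc (length m)))
        ≡⟨ sym (Σℕ-concatMap F (λ i → asPartition (incAt i m)) (upTo (suc (length m)))) ⟩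
      Σℕ F (plusBoxes (m , pm)) ∎
    where
    open ≡-Reasoning
    F : Partition → ℕ
    F μ⁺ = χ (contained μ⁺ (l , pl)) * fSkew μ⁺ (l , pl)
    rowTerm : ∀ i → Σℕ F (asPartition (incAt i m)) ≡ rowContribution m l (fromT pm) (fromT pl) sub i
    rowTerm i = byCase (isPart (incAt i m)) refl
      where
      byCase : ∀ b → isPart (incAt i m) ≡ b →
               Σℕ F (asPartition (incAt i m)) ≡ χ b * (χ (row m i <ᵇ row l i) * cnt (skewB (incAt i m) l))
      byCase false e rewrite asPartition-false (incAt i m) e = refl
      byCase true e with asPartition-true (incAt i m) e
      ... | p , eq rewrite eq | contained-incAt i m p l pl sub | fSkew-cnt (incAt i m , p) (l , pl) = refl

  skewB-self : ∀ m → skewB m m ≡ []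
  skewB-self m = trans (concatMap-upTo-cong (length m) (rowSegment m m) (λ _ → [])
                          (λ j _ → cong (rowBoxes j (row m j)) (n∸n≡0 (row m j))))
                       (noBoxes (upTo (length m)))
    where
    noBoxes : (xs : List ℕ) → concatMap {B = ℕ × ℕ} (λ _ → []) xs ≡ []
    noBoxes [] = refl
    noBoxes (x ∷ xs) = noBoxes xs

  -- f_{μ/μ} = 1: the empty shape has exactly the empty filling
  fSkew-self : ∀ μ → fSkew μ μ ≡ 1
  fSkew-self (m , p) = trans (fSkew-cnt (m , p) (m , p)) (cong cnt (skewB-self m))

module Listings where

  open import Data.Bool using (T?)
  open import Data.Nat using (_<_; z≤n; s≤s; _≟_)
  open import Data.Nat.Properties using (≤-refl; ≤-reflexive; ≤-trans; n≤1+n; +-identityʳ; +-suc; m<m+n)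
  open import Data.List using ([]; _∷_; filter)
  open import Data.List.Membership.Propositional using (_∈_)
  open import Data.List.Membership.Propositional.Properties using (∈-filter⁺; ∈-filter⁻)
  open import Data.List.Relation.Unary.Any using (here; there)
  open import Data.List.Relation.Unary.All using (_∷_)
  open import Data.List.Relation.Unary.AllPairs using (_∷_)
  open import Data.List.Relation.Unary.Unique.Propositional using (Unique)
  import Data.List.Relation.Unary.Unique.Propositional.Properties as Unique
  open import Data.Product using (_,_; proj₁; proj₂)
  open import Data.Empty using (⊥-elim)
  open import Function.Bundles using (mk⇔; Equivalence)
  open import Relation.Nullary using (yes; no)
  open import Relation.Binary.PropositionalEquality
  open Booleans using (fromT; toT)
  open Diagrams
  open SkewCount

  unique-singleton : ∀ (μ : Partition) L → Unique L → (∀ x → x ∈ L → x ≡ μ) → μ ∈ L → L ≡ μ ∷ []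
  unique-singleton μ (x ∷ []) u h m = cong (_∷ []) (h x (here refl))
  unique-singleton μ (x ∷ y ∷ ys) ((x≢y ∷ _) ∷ _) h m = ⊥-elim (x≢y (trans (h x (here refl)) (sym (h y (there (here refl))))))

  listing-zero : ∀ μ L → SkewListing μ 0 L → L ≡ μ ∷ []
  listing-zero μ L (u , eqv) = unique-singleton μ L u onlyμ
    (Equivalence.from (eqv μ) ((λ r → ≤-refl) , sym (+-identityʳ _)))
    where
    onlyμ : ∀ x → x ∈ L → x ≡ μ
    onlyμ (l , pl) mem with Equivalence.to (eqv (l , pl)) mem
    ... | sub , e = partition-≡ (l , pl) μ (partEq l (proj₁ μ) (fromT pl) (fromT (proj₂ μ))
                      (λ r → sym (sizeEq (proj₁ μ) l sub (sym (trans e (+-identityʳ _))) r)))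

  plusBox-⊇ : ∀ μ μ⁺ → μ⁺ ∈ plusBoxes μ → (μ ⊆ₚ μ⁺) × (size μ⁺ ≡ suc (size μ))
  plusBox-⊇ μ μ⁺ mem = rows , trans (cong sizeL μ⁺≡) (size-incAt i (proj₁ μ))
    where
    i = proj₁ (plusBoxes-∈ μ μ⁺ mem)
    μ⁺≡ = proj₂ (plusBoxes-∈ μ μ⁺ mem)
    rows : μ ⊆ₚ μ⁺
    rows r with r ≟ i
    ... | yes refl = subst (row (proj₁ μ) r ≤_) (sym (trans (cong (λ z → row z r) μ⁺≡) (row-incAt-same r (proj₁ μ)))) (n≤1+n _)
    ... | no ne = ≤-reflexive (sym (trans (cong (λ z → row z r) μ⁺≡) (row-incAt-other i (proj₁ μ) r (λ e → ne (sym e)))))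

  listing-step : ∀ μ n L → SkewListing μ (suc n) L → ∀ μ⁺ → μ⁺ ∈ plusBoxes μ →
                 SkewListing μ⁺ n (filter (λ la → T? (contained μ⁺ la)) L)
  listing-step μ n L (u , eqv) μ⁺ mem = Unique.filter⁺ (λ la → T? (contained μ⁺ la)) u , λ la → mk⇔ (to la) (from la)
    where
    μ⊆μ⁺ = proj₁ (plusBox-⊇ μ μ⁺ mem)
    sz = proj₂ (plusBox-⊇ μ μ⁺ mem)
    to : ∀ la → la ∈ filter (λ la → T? (contained μ⁺ la)) L → (μ⁺ ⊆ₚ la) × (size la ≡ size μ⁺ +ℕ n)
    to la m with ∈-filter⁻ (λ la → T? (contained μ⁺ la)) {xs = L} m
    ... | mL , t = contained-sound μ⁺ la (fromT t) ,
                   trans (proj₂ (Equivalence.to (eqv la) mL)) (trans (+-suc (size μ) n) (cong (_+ℕ n) (sym sz)))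
    from : ∀ la → (μ⁺ ⊆ₚ la) × (size la ≡ size μ⁺ +ℕ n) → la ∈ filter (λ la → T? (contained μ⁺ la)) L
    from la (s , e) = ∈-filter⁺ (λ la → T? (contained μ⁺ la))
                        (Equivalence.from (eqv la) ((λ r → ≤-trans (μ⊆μ⁺ r) (s r)) , trans e (trans (cong (_+ℕ n) sz) (sym (+-suc (size μ) n)))))
                        (toT (contained-complete μ⁺ la s))

  listing-member : ∀ μ n L → SkewListing μ (suc n) L → ∀ la → la ∈ L → (μ ⊆ₚ la) × (size μ < size la)
  listing-member μ n L (_ , eqv) la mem =
    proj₁ (Equivalence.to (eqv la) mem) ,
    subst (size μ <_) (sym (proj₂ (Equivalence.to (eqv la) mem))) (m<m+n (size μ) (s≤s z≤n))

module RingSums {c ℓ : Level} (R : CommutativeRing c ℓ) where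

  open CommutativeRing R
  open WithRing R
  open import Relation.Binary.Reasoning.Setoid setoid
  open import Algebra.Properties.CommutativeSemigroup +-commutativeSemigroup
    using () renaming (interchange to +-interchange)
  open import Data.Bool using (Bool; true; false; if_then_else_; T?)
  open import Data.Nat using (zero; _<_; z≤n; s≤s) renaming (_*_ to _*ℕ_)
  import Data.Nat.Properties as ℕₚ
  open import Data.List using ([]; _∷_; map; filter; applyUpTo)
  open import Data.List.Membership.Propositional using (_∈_)
  open import Data.List.Relation.Unary.Any using (here; there)
  open P using (_≡_)
  open import Function using (_∘_)
  open NatSums using (χ; Σℕ)

  sumR-cong : ∀ {A : Set} {f g : A → Carrier} xs → (∀ x → x ∈ xs → f x ≈ g x) → sumR (map f xs) ≈ sumR (map g xs)
  sumR-cong [] h = refl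
  sumR-cong (x ∷ xs) h = +-cong (h x (here P.refl)) (sumR-cong xs (λ y m → h y (there m)))

  sumR-+ : ∀ {A : Set} (f g : A → Carrier) xs → sumR (map (λ x → f x + g x) xs) ≈ sumR (map f xs) + sumR (map g xs)
  sumR-+ f g [] = sym (+-identityˡ 0#)
  sumR-+ f g (x ∷ xs) = trans (+-congˡ (sumR-+ f g xs)) (+-interchange (f x) (g x) _ _)

  sumR-*ʳ : ∀ {A : Set} (f : A → Carrier) a xs → sumR (map (λ x → f x * a) xs) ≈ sumR (map f xs) * a
  sumR-*ʳ f a [] = sym (zeroˡ a)
  sumR-*ʳ f a (x ∷ xs) = trans (+-congˡ (sumR-*ʳ f a xs)) (sym (distribʳ a (f x) _))

  sumR-0 : ∀ {A : Set} (f : A → Carrier) xs → (∀ x → f x ≈ 0#) → sumR (map f xs) ≈ 0#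
  sumR-0 f [] h = refl
  sumR-0 f (x ∷ xs) h = trans (+-cong (h x) (sumR-0 f xs h)) (+-identityˡ 0#)

  sumR-swap : ∀ {A B : Set} (F : A → B → Carrier) xs ys →
    sumR (map (λ x → sumR (map (F x) ys)) xs) ≈ sumR (map (λ y → sumR (map (λ x → F x y) xs)) ys)
  sumR-swap F [] ys = sym (sumR-0 _ ys (λ _ → refl))
  sumR-swap F (x ∷ xs) ys = trans (+-congˡ (sumR-swap F xs ys)) (sym (sumR-+ (F x) _ ys))

  sumR-filter : ∀ {A : Set} (p : A → Bool) (h : A → Carrier) xs →
    sumR (map (λ x → if p x then h x else 0#) xs) ≈ sumR (map h (filter (λ x → T? (p x)) xs))
  sumR-filter p h [] = refl
  sumR-filter p h (x ∷ xs) with p x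
  ... | true = +-congˡ (sumR-filter p h xs)
  ... | false = trans (+-identityˡ _) (sumR-filter p h xs)

  natCast-+ : ∀ m n → natCast (m +ℕ n) ≈ natCast m + natCast n
  natCast-+ zero n = sym (+-identityˡ _)
  natCast-+ (suc m) n = trans (+-congˡ (natCast-+ m n)) (sym (+-assoc 1# _ _))

  natCast-* : ∀ m n → natCast (m *ℕ n) ≈ natCast m * natCast n
  natCast-* zero n = sym (zeroˡ _)
  natCast-* (suc m) n = begin
      natCast (n +ℕ m *ℕ n) ≈⟨ natCast-+ n (m *ℕ n) ⟩
      natCast n + natCast (m *ℕ n) ≈⟨ +-cong (sym (*-identityˡ _)) (natCast-* m n) ⟩
      1# * natCast n + natCast m * natCast n ≈⟨ sym (distribʳ _ 1# _) ⟩
      (1# + natCast m) * natCast n ∎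

  natCast-Σ : ∀ {A : Set} (f : A → ℕ) xs → natCast (Σℕ f xs) ≈ sumR (map (λ x → natCast (f x)) xs)
  natCast-Σ f [] = refl
  natCast-Σ f (x ∷ xs) = trans (natCast-+ (f x) _) (+-congˡ (natCast-Σ f xs))

  natCast-1 : natCast 1 ≈ 1#
  natCast-1 = +-identityʳ 1#

  natCast-χ : ∀ b k y → natCast (χ b *ℕ k) * y ≈ (if b then natCast k * y else 0#)
  natCast-χ true k y = *-congʳ (reflexive (P.cong natCast (ℕₚ.+-identityʳ k)))
  natCast-χ false k y = zeroˡ y

  Sr : ℕ → (ℕ → Carrier) → Carrier
  Sr zero h = 0#
  Sr (suc n) h = h 0 + Sr n (λ i → h (suc i))

  sumR-applyUpTo : ∀ (h : ℕ → Carrier) f n → sumR (map h (applyUpTo f n)) ≡ Sr n (h ∘ f)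
  sumR-applyUpTo h f zero = P.refl
  sumR-applyUpTo h f (suc n) = P.cong (h (f 0) +_) (sumR-applyUpTo h (f ∘ suc) n)

  sumUpTo-Sr : ∀ n h → sumUpTo n h ≡ Sr (suc n) h
  sumUpTo-Sr n h = sumR-applyUpTo h (λ i → i) (suc n)

  Sr-cong : ∀ n {f g : ℕ → Carrier} → (∀ i → i < n → f i ≈ g i) → Sr n f ≈ Sr n g
  Sr-cong zero e = refl
  Sr-cong (suc n) e = +-cong (e 0 (s≤s z≤n)) (Sr-cong n (λ i lt → e (suc i) (s≤s lt)))

  Sr-+ : ∀ n (f g : ℕ → Carrier) → Sr n (λ i → f i + g i) ≈ Sr n f + Sr n g
  Sr-+ zero f g = sym (+-identityˡ 0#)
  Sr-+ (suc n) f g = trans (+-congˡ (Sr-+ n (f ∘ suc) (g ∘ suc))) (+-interchange (f 0) (g 0) _ _)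

  Sr-*ˡ : ∀ n a (f : ℕ → Carrier) → Sr n (λ i → a * f i) ≈ a * Sr n f
  Sr-*ˡ zero a f = sym (zeroʳ a)
  Sr-*ˡ (suc n) a f = trans (+-congˡ (Sr-*ˡ n a (f ∘ suc))) (sym (distribˡ a (f 0) _))

  Sr-last : ∀ n (f : ℕ → Carrier) → Sr (suc n) f ≈ Sr n f + f n
  Sr-last zero f = trans (+-identityʳ (f 0)) (sym (+-identityˡ (f 0)))
  Sr-last (suc n) f = trans (+-congˡ (Sr-last n (f ∘ suc))) (sym (+-assoc (f 0) _ _))

  Sr-extend : ∀ n d (f : ℕ → Carrier) → (∀ i → n ≤ i → f i ≈ 0#) → Sr (n +ℕ d) f ≈ Sr n f
  Sr-extend n zero f e = reflexive (P.cong (λ m → Sr m f) (ℕₚ.+-identityʳ n))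
  Sr-extend n (suc d) f e = begin
      Sr (n +ℕ suc d) f ≡⟨ P.cong (λ m → Sr m f) (ℕₚ.+-suc n d) ⟩
      Sr (suc (n +ℕ d)) f ≈⟨ Sr-last (n +ℕ d) f ⟩
      Sr (n +ℕ d) f + f (n +ℕ d) ≈⟨ +-cong (Sr-extend n d f e) (e (n +ℕ d) (ℕₚ.m≤m+n n d)) ⟩
      Sr n f + 0# ≈⟨ +-identityʳ _ ⟩
      Sr n f ∎

-- Induction on n: expand f_{λ/μ} by the skew recursion, exchange the two sums,
-- and recognise the inner sums as level-n sums for the μ⁺.
module LevelSums {c ℓ : Level} (R : CommutativeRing c ℓ) where

  open CommutativeRing R
  open WithRing R
  open RingSums R
  open import Relation.Binary.Reasoning.Setoid setoid
  open import Data.Bool using (T?)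
  open import Data.Nat using (zero) renaming (_*_ to _*ℕ_)
  open import Data.List using ([]; _∷_; map; filter)
  open import Data.Product using (proj₁; proj₂)
  open NatSums using (χ; Σℕ)
  open SkewCount using (contained; fSkew-recursion; fSkew-self)
  open Listings

  -- E h(ν) = Σ_{ν⁺} h(ν⁺), so that Defs.D h = E h - h
  E : (Partition → Carrier) → Partition → Carrier
  E h ν = sumR (map h (plusBoxes ν))

  Epow : ℕ → (Partition → Carrier) → Partition → Carrier
  Epow zero g = g
  Epow (suc n) g = E (Epow n g)

  levelSum-zero : ∀ g μ → skewSum g μ (μ ∷ []) ≈ g μ
  levelSum-zero g μ = begin
      natCast (fSkew μ μ) * g μ + 0# ≈⟨ +-identityʳ _ ⟩
      natCast (fSkew μ μ) * g μ ≡⟨ P.cong (λ z → natCast z * g μ) (fSkew-self μ) ⟩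
      natCast 1 * g μ ≈⟨ *-congʳ natCast-1 ⟩
      1# * g μ ≈⟨ *-identityˡ _ ⟩
      g μ ∎

  levelSum≈Epow : ∀ n g μ L → SkewListing μ n L → skewSum g μ L ≈ Epow n g μ
  levelSum≈Epow zero g μ L lst = trans (reflexive (P.cong (skewSum g μ) (listing-zero μ L lst))) (levelSum-zero g μ)
  levelSum≈Epow (suc n) g μ L lst = begin
      sumR (map (λ la → natCast (fSkew μ la) * g la) L)
        ≈⟨ sumR-cong L (λ la mem → *-congʳ (reflexive (P.cong natCast
             (fSkew-recursion μ la (proj₁ (listing-member μ n L lst la mem)) (proj₂ (listing-member μ n L lst la mem)))))) ⟩
      sumR (map (λ la → natCast (Σℕ (λ μ⁺ → χ (contained μ⁺ la) *ℕ fSkew μ⁺ la) Pl) * g la) L)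
        ≈⟨ sumR-cong L (λ la _ → trans (*-congʳ (natCast-Σ _ Pl)) (sym (sumR-*ʳ _ (g la) Pl))) ⟩
      sumR (map (λ la → sumR (map (λ μ⁺ → term μ⁺ la) Pl)) L)
        ≈⟨ sumR-swap (λ la μ⁺ → term μ⁺ la) L Pl ⟩
      sumR (map (λ μ⁺ → sumR (map (term μ⁺) L)) Pl)
        ≈⟨ sumR-cong Pl (λ μ⁺ _ → trans (sumR-cong L (λ la _ → natCast-χ (contained μ⁺ la) (fSkew μ⁺ la) (g la)))
                                         (sumR-filter (contained μ⁺) (λ la → natCast (fSkew μ⁺ la) * g la) L)) ⟩
      sumR (map (λ μ⁺ → skewSum g μ⁺ (filter (λ la → T? (contained μ⁺ la)) L)) Pl)
        ≈⟨ sumR-cong Pl (λ μ⁺ mem → levelSum≈Epow n g μ⁺ _ (listing-step μ n L lst μ⁺ mem)) ⟩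
      E (Epow n g) μ ∎
    where
    Pl = plusBoxes μ
    term : Partition → Partition → Carrier
    term μ⁺ la = natCast (χ (contained μ⁺ la) *ℕ fSkew μ⁺ la) * g la

-- Both follow by
-- induction on n from one Pascal-rule step for weighted binomial sums, since
-- E = D + 1 and E, D commute with the powers of each other.
module Binomial {c ℓ : Level} (R : CommutativeRing c ℓ) where

  open CommutativeRing R
  open WithRing R
  open RingSums R
  open LevelSums R
  open import Relation.Binary.Reasoning.Setoid setoid
  open import Algebra.Properties.Ring ring using (-1*x≈-x; x[y-z]≈xy-xz)
  open import Algebra.Properties.AbelianGroup +-abelianGroup using (⁻¹-∙-comm)
  open import Algebra.Properties.Group +-group using (⁻¹-involutive)
  open import Algebra.Properties.CommutativeSemigroup +-commutativeSemigroup
    using () renaming (interchange to +-interchange; x∙yz≈y∙xz to +-leftComm)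
  open import Data.Nat using (zero)
  import Data.Nat.Properties as ℕₚ
  open import Data.Nat.Combinatorics using (nCk+nC[k+1]≡[n+1]C[k+1]; k>n⇒nCk≡0)
  open import Function using (_∘_)

  -- one Pascal step for Σ_k w(n+k) C(n,k) x_k, for weights with w(m+1) = s·w(m)
  -- and w(m+2) = w(m) (w = 1, s = 1 and w = (-1)ᵐ, s = -1)
  pascalStep : ∀ (w : ℕ → Carrier) (s : Carrier) → (∀ m → w (suc m) ≈ s * w m) → (∀ m → w (suc (suc m)) ≈ w m) →
    ∀ n (x : ℕ → Carrier) →
    Sr (suc (suc n)) (λ k → w (suc n +ℕ k) * (natCast (suc n C k) * x k))
      ≈ Sr (suc n) (λ k → w (n +ℕ k) * (natCast (n C k) * x (suc k))) + s * Sr (suc n) (λ k → w (n +ℕ k) * (natCast (n C k) * x k))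
  pascalStep w s w1 w2 n x = begin
      f 0 + Sr (suc n) (f ∘ suc)
        ≈⟨ +-congˡ (Sr-cong (suc n) (λ k _ → fsuc k)) ⟩
      f 0 + Sr (suc n) (λ k → a k + b k)
        ≈⟨ +-congˡ (Sr-+ (suc n) a b) ⟩
      f 0 + (Sr (suc n) a + Sr (suc n) b)
        ≈⟨ +-congˡ (+-congˡ (trans (Sr-last n b) (trans (+-congˡ bLast) (+-identityʳ _)))) ⟩
      f 0 + (Sr (suc n) a + Sr n b)
        ≈⟨ +-leftComm (f 0) _ _ ⟩
      Sr (suc n) a + (f 0 + Sr n b)
        ≈⟨ +-congˡ (+-cong f0 (Sr-cong n (λ k _ → bShift k))) ⟩
      Sr (suc n) a + (s * g 0 + Sr n (λ k → s * g (suc k)))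
        ≈⟨ +-congˡ (+-congˡ (Sr-*ˡ n s (g ∘ suc))) ⟩
      Sr (suc n) a + (s * g 0 + s * Sr n (g ∘ suc))
        ≈⟨ +-congˡ (sym (distribˡ s (g 0) _)) ⟩
      Sr (suc n) a + s * Sr (suc n) g ∎
    where
    f a b g : ℕ → Carrier
    f k = w (suc n +ℕ k) * (natCast (suc n C k) * x k)
    a k = w (n +ℕ k) * (natCast (n C k) * x (suc k))
    b k = w (n +ℕ k) * (natCast (n C suc k) * x (suc k))
    g k = w (n +ℕ k) * (natCast (n C k) * x k)
    wss : ∀ k → w (suc (n +ℕ suc k)) ≈ w (n +ℕ k)
    wss k = trans (reflexive (P.cong (λ z → w (suc z)) (ℕₚ.+-suc n k))) (w2 (n +ℕ k))
    fsuc : ∀ k → f (suc k) ≈ a k + b k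
    fsuc k = begin
        w (suc n +ℕ suc k) * (natCast (suc n C suc k) * x (suc k))
          ≈⟨ *-cong (wss k) (*-congʳ (reflexive (P.cong natCast (P.sym (nCk+nC[k+1]≡[n+1]C[k+1] n k))))) ⟩
        w (n +ℕ k) * (natCast (n C k +ℕ n C suc k) * x (suc k))
          ≈⟨ *-congˡ (*-congʳ (natCast-+ (n C k) (n C suc k))) ⟩
        w (n +ℕ k) * ((natCast (n C k) + natCast (n C suc k)) * x (suc k))
          ≈⟨ *-congˡ (distribʳ (x (suc k)) _ _) ⟩
        w (n +ℕ k) * (natCast (n C k) * x (suc k) + natCast (n C suc k) * x (suc k))
          ≈⟨ distribˡ (w (n +ℕ k)) _ _ ⟩
        a k + b k ∎
    bLast : b n ≈ 0#
    bLast = trans (*-congˡ (trans (*-congʳ (reflexive (P.cong natCast (k>n⇒nCk≡0 (ℕₚ.n<1+n n))))) (zeroˡ _))) (zeroʳ _)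
    f0 : f 0 ≈ s * g 0
    f0 = sym (trans (sym (*-assoc s (w (n +ℕ 0)) _)) (*-congʳ (sym (w1 (n +ℕ 0)))))
    bShift : ∀ k → b k ≈ s * g (suc k)
    bShift k = sym (trans (sym (*-assoc s (w (n +ℕ suc k)) _)) (*-congʳ (trans (sym (w1 (n +ℕ suc k))) (wss k))))

  _≗_ : (Partition → Carrier) → (Partition → Carrier) → Set _
  f ≗ g = ∀ ν → f ν ≈ g ν

  E≗D+1 : ∀ h → E h ≗ (λ ν → D h ν + h ν)
  E≗D+1 h ν = sym (trans (+-assoc (E h ν) (- h ν) (h ν)) (trans (+-congˡ (-‿inverseˡ (h ν))) (+-identityʳ (E h ν))))

  D-cong : ∀ {f g} → f ≗ g → D f ≗ D g
  D-cong e ν = +-cong (sumR-cong (plusBoxes ν) (λ x _ → e x)) (-‿cong (e ν))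

  D-+ : ∀ f g → D (λ ν → f ν + g ν) ≗ (λ ν → D f ν + D g ν)
  D-+ f g ν = trans (+-congʳ (sumR-+ f g (plusBoxes ν)))
                    (trans (+-congˡ (sym (⁻¹-∙-comm (f ν) (g ν)))) (+-interchange _ _ (- f ν) (- g ν)))

  Dpow-cong : ∀ k {f g} → f ≗ g → Dpow k f ≗ Dpow k g
  Dpow-cong zero e = e
  Dpow-cong (suc k) e = D-cong (Dpow-cong k e)

  Dpow-+ : ∀ k f g → Dpow k (λ ν → f ν + g ν) ≗ (λ ν → Dpow k f ν + Dpow k g ν)
  Dpow-+ zero f g ν = refl
  Dpow-+ (suc k) f g ν = trans (D-cong (Dpow-+ k f g) ν) (D-+ (Dpow k f) (Dpow k g) ν)

  Dpow-D : ∀ k h → Dpow k (D h) ≗ D (Dpow k h)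
  Dpow-D zero h ν = refl
  Dpow-D (suc k) h = D-cong (Dpow-D k h)

  Dpow-E : ∀ k h → Dpow k (E h) ≗ (λ ν → Dpow (suc k) h ν + Dpow k h ν)
  Dpow-E k h ν = trans (Dpow-cong k (E≗D+1 h) ν) (trans (Dpow-+ k (D h) h ν) (+-congʳ (Dpow-D k h ν)))

  Epow-cong : ∀ k {f g} → f ≗ g → Epow k f ≗ Epow k g
  Epow-cong zero e = e
  Epow-cong (suc k) e ν = sumR-cong (plusBoxes ν) (λ x _ → Epow-cong k e x)

  Epow-+ : ∀ k f g → Epow k (λ ν → f ν + g ν) ≗ (λ ν → Epow k f ν + Epow k g ν)
  Epow-+ zero f g ν = refl
  Epow-+ (suc k) f g ν = trans (sumR-cong (plusBoxes ν) (λ x _ → Epow-+ k f g x)) (sumR-+ (Epow k f) (Epow k g) (plusBoxes ν))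

  Epow-E : ∀ k g → Epow k (E g) ≗ Epow (suc k) g
  Epow-E zero g ν = refl
  Epow-E (suc k) g ν = sumR-cong (plusBoxes ν) (λ x _ → Epow-E k g x)

  Epow-D : ∀ k g → Epow k (D g) ≗ (λ ν → Epow (suc k) g ν - Epow k g ν)
  Epow-D k g ν = begin
      Epow k (D g) ν                                        ≈⟨ sym (+-identityʳ _) ⟩
      Epow k (D g) ν + 0#                                   ≈⟨ +-congˡ (sym (-‿inverseʳ (Epow k g ν))) ⟩
      Epow k (D g) ν + (Epow k g ν - Epow k g ν)            ≈⟨ sym (+-assoc _ _ _) ⟩
      (Epow k (D g) ν + Epow k g ν) - Epow k g ν            ≈⟨ +-congʳ (sym (trans (Epow-cong k (E≗D+1 g) ν) (Epow-+ k (D g) g ν))) ⟩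
      Epow k (E g) ν - Epow k g ν                           ≈⟨ +-congʳ (Epow-E k g ν) ⟩
      Epow (suc k) g ν - Epow k g ν ∎

  Epow-binomial : ∀ n g ν → Epow n g ν ≈ Sr (suc n) (λ k → natCast (n C k) * Dpow k g ν)
  Epow-binomial zero g ν = sym (trans (+-identityʳ _) (trans (*-congʳ natCast-1) (*-identityˡ (g ν))))
  Epow-binomial (suc n) g ν = begin
      Epow (suc n) g ν
        ≈⟨ sym (Epow-E n g ν) ⟩
      Epow n (E g) ν
        ≈⟨ Epow-binomial n (E g) ν ⟩
      Sr (suc n) (λ k → natCast (n C k) * Dpow k (E g) ν)
        ≈⟨ Sr-cong (suc n) {g = λ k → A k + B k} (λ k _ → trans (*-congˡ (Dpow-E k g ν)) (distribˡ _ _ _)) ⟩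
      Sr (suc n) (λ k → A k + B k)
        ≈⟨ Sr-+ (suc n) A B ⟩
      Sr (suc n) A + Sr (suc n) B
        ≈⟨ sym (+-cong (Sr-cong (suc n) {f = λ k → 1# * A k} (λ k _ → *-identityˡ (A k)))
                       (trans (*-identityˡ _) (Sr-cong (suc n) {f = λ k → 1# * B k} (λ k _ → *-identityˡ (B k))))) ⟩
      Sr (suc n) (λ k → 1# * A k) + 1# * Sr (suc n) (λ k → 1# * B k)
        ≈⟨ sym (pascalStep (λ _ → 1#) 1# (λ m → sym (*-identityˡ 1#)) (λ m → refl) n x) ⟩
      Sr (suc (suc n)) (λ k → 1# * (natCast (suc n C k) * x k))
        ≈⟨ Sr-cong (suc (suc n)) {g = λ k → natCast (suc n C k) * x k} (λ k _ → *-identityˡ _) ⟩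
      Sr (suc (suc n)) (λ k → natCast (suc n C k) * x k) ∎
    where
    x A B : ℕ → Carrier
    x k = Dpow k g ν
    A k = natCast (n C k) * x (suc k)
    B k = natCast (n C k) * x k

  Dpow-binomial : ∀ n g ν → Dpow n g ν ≈ Sr (suc n) (λ k → negOnePow (n +ℕ k) * (natCast (n C k) * Epow k g ν))
  Dpow-binomial zero g ν = sym (trans (+-identityʳ _) (trans (*-identityˡ _) (trans (*-congʳ natCast-1) (*-identityˡ (g ν)))))
  Dpow-binomial (suc n) g ν = begin
      D (Dpow n g) ν
        ≈⟨ sym (Dpow-D n g ν) ⟩
      Dpow n (D g) ν
        ≈⟨ Dpow-binomial n (D g) ν ⟩
      Sr (suc n) (λ k → w (n +ℕ k) * (natCast (n C k) * Epow k (D g) ν))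
        ≈⟨ Sr-cong (suc n) {g = λ k → A k + - 1# * B k} (λ k _ → split k) ⟩
      Sr (suc n) (λ k → A k + - 1# * B k)
        ≈⟨ Sr-+ (suc n) A (λ k → - 1# * B k) ⟩
      Sr (suc n) A + Sr (suc n) (λ k → - 1# * B k)
        ≈⟨ +-congˡ (Sr-*ˡ (suc n) (- 1#) B) ⟩
      Sr (suc n) A + - 1# * Sr (suc n) B
        ≈⟨ sym (pascalStep w (- 1#) (λ m → sym (-1*x≈-x (w m))) (λ m → ⁻¹-involutive (w m)) n y) ⟩
      Sr (suc (suc n)) (λ k → w (suc n +ℕ k) * (natCast (suc n C k) * y k)) ∎
    where
    w = negOnePow
    y A B : ℕ → Carrier
    y k = Epow k g ν
    A k = w (n +ℕ k) * (natCast (n C k) * y (suc k))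
    B k = w (n +ℕ k) * (natCast (n C k) * y k)
    split : ∀ k → w (n +ℕ k) * (natCast (n C k) * Epow k (D g) ν) ≈ A k + - 1# * B k
    split k = begin
        w (n +ℕ k) * (natCast (n C k) * Epow k (D g) ν)
          ≈⟨ *-congˡ (*-congˡ (Epow-D k g ν)) ⟩
        w (n +ℕ k) * (natCast (n C k) * (y (suc k) - y k))
          ≈⟨ *-congˡ (x[y-z]≈xy-xz _ _ _) ⟩
        w (n +ℕ k) * (natCast (n C k) * y (suc k) - natCast (n C k) * y k)
          ≈⟨ x[y-z]≈xy-xz _ _ _ ⟩
        A k - B k
          ≈⟨ +-congˡ (sym (-1*x≈-x _)) ⟩
        A k + - 1# * B k ∎

-- If Dʳg ≡ 0, the expansion Eⁿg(μ) = Σ_k C(n,k) Dᵏg(μ) stops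
-- at k < r, and when the positive integers are invertible each C(n,k) is the
-- value at n of the polynomial x(x-1)⋯(x-k+1)/k!, built by the recursion
-- (k+1) C(n,k+1) = (n - k) C(n,k).
module Polynomiality where

  open import Data.Nat using (zero; z≤n; s≤s) renaming (_*_ to _*ℕ_; _∸_ to _∸ℕ_)
  import Data.Nat.Properties as ℕₚ
  open import Data.Nat.Combinatorics using (nCk+nC[k+1]≡[n+1]C[k+1]; k>n⇒nCk≡0; nC1≡n)
  open import Data.Nat.Tactic.RingSolver using (solve-∀)
  open import Data.List using ([]; _∷_; map)
  open import Data.Product using (_,_; proj₁; proj₂)
  open P using (_≡_)

  binomial-absorption : ∀ n k → suc k *ℕ (n C suc k) +ℕ k *ℕ (n C k) ≡ n *ℕ (n C k)
  binomial-absorption zero zero = P.refl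
  binomial-absorption zero (suc k)
    rewrite k>n⇒nCk≡0 {0} {suc (suc k)} (s≤s z≤n) | k>n⇒nCk≡0 {0} {suc k} (s≤s z≤n) =
    P.cong₂ _+ℕ_ (ℕₚ.*-zeroʳ (suc (suc k))) (ℕₚ.*-zeroʳ (suc k))
  binomial-absorption (suc n) zero rewrite nC1≡n (suc n) =
    P.trans (ℕₚ.+-identityʳ (suc n +ℕ 0)) (P.trans (ℕₚ.+-identityʳ (suc n)) (P.sym (ℕₚ.*-identityʳ (suc n))))
  binomial-absorption (suc n) (suc k) = begin
      suc (suc k) *ℕ (suc n C suc (suc k)) +ℕ suc k *ℕ (suc n C suc k)
        ≡⟨ P.cong₂ (λ u v → suc (suc k) *ℕ u +ℕ suc k *ℕ v)
                   (P.sym (nCk+nC[k+1]≡[n+1]C[k+1] n (suc k))) (P.sym (nCk+nC[k+1]≡[n+1]C[k+1] n k)) ⟩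
      suc (suc k) *ℕ (b +ℕ c) +ℕ suc k *ℕ (a +ℕ b)
        ≡⟨ regroup k a b c ⟩
      (suc (suc k) *ℕ c +ℕ suc k *ℕ b) +ℕ ((suc k *ℕ b +ℕ k *ℕ a) +ℕ (a +ℕ b))
        ≡⟨ P.cong₂ (λ u v → u +ℕ (v +ℕ (a +ℕ b))) (binomial-absorption n (suc k)) (binomial-absorption n k) ⟩
      n *ℕ b +ℕ (n *ℕ a +ℕ (a +ℕ b))
        ≡⟨ collect n a b ⟩
      suc n *ℕ (a +ℕ b)
        ≡⟨ P.cong (suc n *ℕ_) (nCk+nC[k+1]≡[n+1]C[k+1] n k) ⟩
      suc n *ℕ (suc n C suc k) ∎
    where
    open P.≡-Reasoning
    a b c : ℕ
    a = n C k
    b = n C suc k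
    c = n C suc (suc k)
    regroup : ∀ k a b c → suc (suc k) *ℕ (b +ℕ c) +ℕ suc k *ℕ (a +ℕ b) ≡
                          (suc (suc k) *ℕ c +ℕ suc k *ℕ b) +ℕ ((suc k *ℕ b +ℕ k *ℕ a) +ℕ (a +ℕ b))
    regroup = solve-∀
    collect : ∀ n a b → n *ℕ b +ℕ (n *ℕ a +ℕ (a +ℕ b)) ≡ suc n *ℕ (a +ℕ b)
    collect = solve-∀

  module _ {c ℓ : Level} (R : CommutativeRing c ℓ) where

    open CommutativeRing R
    open WithRing R
    open RingSums R
    open Binomial R using (Epow-binomial; D-cong)
    open LevelSums R using (Epow; levelSum≈Epow)
    open import Relation.Binary.Reasoning.Setoid setoid
    open import Algebra.Properties.Ring ring using (-‿distribˡ-*)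
    open import Algebra.Properties.CommutativeSemigroup +-commutativeSemigroup
      using () renaming (interchange to +-interchange)
    open import Algebra.Properties.CommutativeSemigroup *-commutativeSemigroup
      using () renaming (x∙yz≈y∙xz to *-leftComm)

    binomial-absorptionᴿ : ∀ n k → natCast (suc k) * natCast (n C suc k) + natCast k * natCast (n C k) ≈ natCast n * natCast (n C k)
    binomial-absorptionᴿ n k = begin
        natCast (suc k) * natCast (n C suc k) + natCast k * natCast (n C k)
          ≈⟨ sym (+-cong (natCast-* (suc k) (n C suc k)) (natCast-* k (n C k))) ⟩
        natCast (suc k *ℕ (n C suc k)) + natCast (k *ℕ (n C k))
          ≈⟨ sym (natCast-+ (suc k *ℕ (n C suc k)) (k *ℕ (n C k))) ⟩
        natCast (suc k *ℕ (n C suc k) +ℕ k *ℕ (n C k))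
          ≡⟨ P.cong natCast (binomial-absorption n k) ⟩
        natCast (n *ℕ (n C k))
          ≈⟨ natCast-* n (n C k) ⟩
        natCast n * natCast (n C k) ∎

    addPoly : List Carrier → List Carrier → List Carrier
    addPoly [] q = q
    addPoly (a ∷ p) [] = a ∷ p
    addPoly (a ∷ p) (b ∷ q) = (a + b) ∷ addPoly p q

    evalPoly-add : ∀ p q x → evalPoly (addPoly p q) x ≈ evalPoly p x + evalPoly q x
    evalPoly-add [] q x = sym (+-identityˡ _)
    evalPoly-add (a ∷ p) [] x = sym (+-identityʳ _)
    evalPoly-add (a ∷ p) (b ∷ q) x = begin
        (a + b) + x * evalPoly (addPoly p q) x ≈⟨ +-congˡ (*-congˡ (evalPoly-add p q x)) ⟩
        (a + b) + x * (evalPoly p x + evalPoly q x) ≈⟨ +-congˡ (distribˡ x _ _) ⟩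
        (a + b) + (x * evalPoly p x + x * evalPoly q x) ≈⟨ +-interchange a b _ _ ⟩
        (a + x * evalPoly p x) + (b + x * evalPoly q x) ∎

    evalPoly-scale : ∀ s p x → evalPoly (map (s *_) p) x ≈ s * evalPoly p x
    evalPoly-scale s [] x = sym (zeroʳ s)
    evalPoly-scale s (a ∷ p) x = begin
        s * a + x * evalPoly (map (s *_) p) x ≈⟨ +-congˡ (*-congˡ (evalPoly-scale s p x)) ⟩
        s * a + x * (s * evalPoly p x) ≈⟨ +-congˡ (*-leftComm x s _) ⟩
        s * a + s * (x * evalPoly p x) ≈⟨ sym (distribˡ s a _) ⟩
        s * (a + x * evalPoly p x) ∎

    module _ (inv : ℕ → Carrier) (inv-correct : ∀ m → natCast (suc m) * inv m ≈ 1#) where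

      -- binomialPoly k: the polynomial x ↦ C(x,k), as (x - k) · C(x,k) / (k+1)
      binomialPoly : ℕ → List Carrier
      binomialPoly zero = 1# ∷ []
      binomialPoly (suc k) = map (inv k *_) (addPoly (0# ∷ binomialPoly k) (map (- natCast k *_) (binomialPoly k)))

      evalPoly-binomial : ∀ k n → evalPoly (binomialPoly k) (natCast n) ≈ natCast (n C k)
      evalPoly-binomial zero n = trans (trans (+-congˡ (zeroʳ _)) (+-identityʳ 1#)) (sym natCast-1)
      evalPoly-binomial (suc k) n = begin
          evalPoly (binomialPoly (suc k)) X
            ≈⟨ evalPoly-scale (inv k) (addPoly (0# ∷ binomialPoly k) (map (- K *_) (binomialPoly k))) X ⟩
          inv k * evalPoly (addPoly (0# ∷ binomialPoly k) (map (- K *_) (binomialPoly k))) X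
            ≈⟨ *-congˡ (evalPoly-add (0# ∷ binomialPoly k) (map (- K *_) (binomialPoly k)) X) ⟩
          inv k * ((0# + X * e) + evalPoly (map (- K *_) (binomialPoly k)) X)
            ≈⟨ *-congˡ (+-cong (+-identityˡ _) (evalPoly-scale (- K) (binomialPoly k) X)) ⟩
          inv k * (X * e + - K * e)
            ≈⟨ *-congˡ (+-cong (*-congˡ (evalPoly-binomial k n)) (*-congˡ (evalPoly-binomial k n))) ⟩
          inv k * (X * Ck + - K * Ck)
            ≈⟨ *-congˡ (+-congˡ (sym (-‿distribˡ-* K Ck))) ⟩
          inv k * (X * Ck - K * Ck)
            ≈⟨ *-congˡ absorption ⟩
          inv k * (natCast (suc k) * C')
            ≈⟨ sym (*-assoc _ _ _) ⟩
          (inv k * natCast (suc k)) * C'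
            ≈⟨ *-congʳ (trans (*-comm _ _) (inv-correct k)) ⟩
          1# * C'
            ≈⟨ *-identityˡ C' ⟩
          C' ∎
        where
        X = natCast n
        K = natCast k
        e = evalPoly (binomialPoly k) X
        Ck = natCast (n C k)
        C' = natCast (n C suc k)
        absorption : X * Ck - K * Ck ≈ natCast (suc k) * C'
        absorption = begin
            X * Ck - K * Ck                                    ≈⟨ +-congʳ (sym (binomial-absorptionᴿ n k)) ⟩
            (natCast (suc k) * C' + K * Ck) - K * Ck           ≈⟨ +-assoc _ _ _ ⟩
            natCast (suc k) * C' + (K * Ck - K * Ck)           ≈⟨ +-congˡ (-‿inverseʳ _) ⟩
            natCast (suc k) * C' + 0#                          ≈⟨ +-identityʳ _ ⟩
            natCast (suc k) * C' ∎

      binomialCombination : (ℕ → Carrier) → ℕ → List Carrier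
      binomialCombination d zero = []
      binomialCombination d (suc r) = addPoly (binomialCombination d r) (map (d r *_) (binomialPoly r))

      evalPoly-binomialCombination : ∀ d r n →
        evalPoly (binomialCombination d r) (natCast n) ≈ Sr r (λ k → d k * natCast (n C k))
      evalPoly-binomialCombination d zero n = refl
      evalPoly-binomialCombination d (suc r) n = begin
          evalPoly (addPoly (binomialCombination d r) (map (d r *_) (binomialPoly r))) X
            ≈⟨ evalPoly-add (binomialCombination d r) _ X ⟩
          evalPoly (binomialCombination d r) X + evalPoly (map (d r *_) (binomialPoly r)) X
            ≈⟨ +-cong (evalPoly-binomialCombination d r n) (trans (evalPoly-scale (d r) (binomialPoly r) X) (*-congˡ (evalPoly-binomial r n))) ⟩
          Sr r (λ k → d k * natCast (n C k)) + d r * natCast (n C r)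
            ≈⟨ sym (Sr-last r (λ k → d k * natCast (n C k))) ⟩
          Sr (suc r) (λ k → d k * natCast (n C k)) ∎
        where X = natCast n

    Dpow-vanish : ∀ g r → (∀ ν → Dpow r g ν ≈ 0#) → ∀ k → r ≤ k → ∀ ν → Dpow k g ν ≈ 0#
    Dpow-vanish g r hz k le = P.subst (λ j → ∀ ν → Dpow j g ν ≈ 0#) (ℕₚ.m∸n+n≡m le) (above (k ∸ℕ r))
      where
      D0 : ∀ ν → D (λ _ → 0#) ν ≈ 0#
      D0 ν = trans (+-congʳ (sumR-0 (λ _ → 0#) (plusBoxes ν) (λ _ → refl))) (-‿inverseʳ 0#)
      above : ∀ j ν → Dpow (j +ℕ r) g ν ≈ 0#
      above zero ν = hz ν
      above (suc j) ν = trans (D-cong (above j) ν) (D0 ν)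

    Epow-truncated : ∀ g μ r → (∀ ν → Dpow r g ν ≈ 0#) → ∀ n →
                     Epow n g μ ≈ Sr r (λ k → Dpow k g μ * natCast (n C k))
    Epow-truncated g μ r hz n = begin
        Epow n g μ
          ≈⟨ Epow-binomial n g μ ⟩
        Sr (suc n) F
          ≈⟨ sym (Sr-extend (suc n) r F (λ k le → trans (*-congʳ (reflexive (P.cong natCast (k>n⇒nCk≡0 le)))) (zeroˡ _))) ⟩
        Sr (suc n +ℕ r) F
          ≡⟨ P.cong (λ z → Sr z F) (ℕₚ.+-comm (suc n) r) ⟩
        Sr (r +ℕ suc n) F
          ≈⟨ Sr-extend r (suc n) F (λ k le → trans (*-congˡ (Dpow-vanish g r hz k le μ)) (zeroʳ _)) ⟩
        Sr r F
          ≈⟨ Sr-cong r (λ k _ → *-comm _ _) ⟩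
        Sr r (λ k → Dpow k g μ * natCast (n C k)) ∎
      where
      F : ℕ → Carrier
      F k = natCast (n C k) * Dpow k g μ

    -- the polynomiality statement of Theorem 1.6
    levelSum-polynomial : ∀ g μ → (∀ (m : ℕ) → ∃ λ y → natCast (suc m) * y ≈ 1#) →
      ∀ r → (∀ λ' → Dpow r g λ' ≈ 0#) →
      ∃ λ (cs : List Carrier) → ∀ (n : ℕ) (L : List Partition) → SkewListing μ n L →
        skewSum g μ L ≈ evalPoly cs (natCast n)
    levelSum-polynomial g μ units r hz = binomialCombination inv inv-correct d r , λ n L lst → begin
        skewSum g μ L                                              ≈⟨ levelSum≈Epow n g μ L lst ⟩
        _                                                          ≈⟨ Epow-truncated g μ r hz n ⟩
        Sr r (λ k → d k * natCast (n C k))                         ≈⟨ sym (evalPoly-binomialCombination inv inv-correct d r n) ⟩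
        evalPoly (binomialCombination inv inv-correct d r) (natCast n) ∎
      where
      inv : ℕ → Carrier
      inv m = proj₁ (units m)
      inv-correct : ∀ m → natCast (suc m) * inv m ≈ 1#
      inv-correct m = proj₂ (units m)
      d : ℕ → Carrier
      d k = Dpow k g μ

-- Theorem 1.6.  Each part identifies the level sums with Eⁿg(μ) and then
-- applies the corresponding expansion.
theorem1p6 : ∀ {c ℓ : Level} (R : CommutativeRing c ℓ) →
    let open CommutativeRing R in let open WithRing R in
    (g : Partition → Carrier) (μ : Partition) →
      (∀ (n : ℕ) (L : List Partition) → SkewListing μ n L →
        skewSum g μ L ≈ sumUpTo n (λ k → natCast (n C k) * Dpow k g μ))
    × (∀ (n : ℕ) (Ls : ℕ → List Partition) → (∀ k → SkewListing μ k (Ls k)) →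
        Dpow n g μ ≈ sumUpTo n (λ k → negOnePow (n +ℕ k) * (natCast (n C k) * skewSum g μ (Ls k))))
    × ((∀ (m : ℕ) → ∃ λ y → natCast (suc m) * y ≈ 1#) →
        ∀ (r : ℕ) → 1 ≤ r → (∀ λ' → Dpow r g λ' ≈ 0#) →
        ∃ λ (cs : List Carrier) → ∀ (n : ℕ) (L : List Partition) → SkewListing μ n L →
          skewSum g μ L ≈ evalPoly cs (natCast n))
theorem1p6 R g μ = levelSum-expansion , Dpow-expansion , λ units r _ → levelSum-polynomial R g μ units r
  where
  open CommutativeRing R
  open WithRing R
  open RingSums R using (Sr-cong; sumUpTo-Sr)
  open LevelSums R using (levelSum≈Epow)
  open Binomial R using (Epow-binomial; Dpow-binomial)
  open Polynomiality using (levelSum-polynomial)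

  levelSum-expansion : ∀ n L → SkewListing μ n L → skewSum g μ L ≈ sumUpTo n (λ k → natCast (n C k) * Dpow k g μ)
  levelSum-expansion n L lst =
    trans (levelSum≈Epow n g μ L lst)
          (trans (Epow-binomial n g μ) (reflexive (P.sym (sumUpTo-Sr n _))))

  Dpow-expansion : ∀ n Ls → (∀ k → SkewListing μ k (Ls k)) →
    Dpow n g μ ≈ sumUpTo n (λ k → negOnePow (n +ℕ k) * (natCast (n C k) * skewSum g μ (Ls k)))
  Dpow-expansion n Ls lsts =
    trans (Dpow-binomial n g μ)
          (trans (Sr-cong (suc n) {g = λ k → negOnePow (n +ℕ k) * (natCast (n C k) * skewSum g μ (Ls k))}
                          (λ k _ → *-congˡ (*-congˡ (sym (levelSum≈Epow k g μ (Ls k) (lsts k))))))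
                 (reflexive (P.sym (sumUpTo-Sr n _))))
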